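{- For all $n \geq 6$, \[\mathrm{ex}(n,R_3) = \left\lfloor \frac{n}{2} \right\rfloor \left\lceil \frac{n}{2} \right\rceil \frac{n-2}{2}.\] Moreover, for each such $n$ there is exactly one $R_3$-free graph on $n$ vertices with this many edges, up to isomorphism.
   Context: A $2\to1$ directed hypergraph (here simply a "graph") is a pair $H=(V,E)$ with $V$ a finite vertex set and $E$ a set of edges, each edge being a 3-element subset $\{a,b,c\}$ of $V$ with one element marked as the head; the edge with underlying set $\{a,b,c\}$ and head $c$ is written $ab \to c$. A triple of vertices may carry up to three distinct edges (one for each choice of head). A homomorphism $\phi:F\to G$ is a map $V(F)\to V(G)$ with $ab\to c\in E(F)\Rightarrow \phi(a)\phi(b)\to\phi(c)\in E(G)$. $G$ is $F$-free if there is no injective homomorphism $F\to G$. $\mathrm{ex}(n,F)$ is the maximum number of edges of an $F$-free graph on $n$ vertices. $R_3$ is the graph with vertex set $\{a,b,c,d\}$ and edge set $\{ab\to c,\ bc\to d\}$. -}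

module Defs where

open import Data.Bool using (Bool; true; false; _∧_)
open import Data.Fin using (Fin; zero; suc; toℕ)
open import Data.Nat using (ℕ; _≤_; _∸_; _*_; _/_; ⌊_/2⌋; ⌈_/2⌉; _<ᵇ_)
open import Data.List using (List; length; filterᵇ; allFin; cartesianProduct)
open import Data.Product using (Σ; _×_; _,_)
open import Relation.Binary.PropositionalEquality using (_≡_; _≢_; refl)
open import Relation.Nullary using (¬_)
open import Function.Definitions using (Injective; Bijective)

-- A 2→1 directed hypergraph on vertex set Fin n.
-- edge a b c = true  means the edge  ab → c  (tails {a,b}, head c) is present.
record Graph (n : ℕ) : Set where
  field
    edge     : Fin n → Fin n → Fin n → Bool
    sym      : ∀ a b c → edge a b c ≡ edge b a c
    loopless : ∀ a b c → edge a b c ≡ true → (a ≢ b) × (a ≢ c) × (b ≢ c)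
open Graph public

triples : (n : ℕ) → List (Fin n × Fin n × Fin n)
triples n = cartesianProduct (allFin n) (cartesianProduct (allFin n) (allFin n))

-- number of edges: each edge ab → c is counted once, via toℕ a < toℕ b
edgeCount : {n : ℕ} → Graph n → ℕ
edgeCount {n} G =
  length (filterᵇ (λ { (a , b , c) → (toℕ a <ᵇ toℕ b) ∧ edge G a b c }) (triples n))

IsHom : {k n : ℕ} → Graph k → Graph n → (Fin k → Fin n) → Set
IsHom F G φ = ∀ a b c → edge F a b c ≡ true → edge G (φ a) (φ b) (φ c) ≡ true

Free : {k n : ℕ} → Graph k → Graph n → Set
Free {k} {n} F G = ¬ (Σ (Fin k → Fin n) (λ φ → Injective _≡_ _≡_ φ × IsHom F G φ))

IsEx : {k : ℕ} → Graph k → ℕ → ℕ → Set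
IsEx F n m =
  Σ (Graph n) (λ G → Free F G × edgeCount G ≡ m)
  × ((G : Graph n) → Free F G → edgeCount G ≤ m)

_≅_ : {n : ℕ} → Graph n → Graph n → Set
_≅_ {n} G H = Σ (Fin n → Fin n) (λ φ → Bijective _≡_ _≡_ φ
                × (∀ a b c → edge G a b c ≡ edge H (φ a) (φ b) (φ c)))

-- R₃ on vertices a=0, b=1, c=2, d=3 with edges ab → c and bc → d
R3-edge : Fin 4 → Fin 4 → Fin 4 → Bool
R3-edge zero (suc zero) (suc (suc zero)) = true
R3-edge (suc zero) zero (suc (suc zero)) = true
R3-edge (suc zero) (suc (suc zero)) (suc (suc (suc zero))) = true
R3-edge (suc (suc zero)) (suc zero) (suc (suc (suc zero))) = true
R3-edge _ _ _ = false

private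
  R3-sym : ∀ a b c → R3-edge a b c ≡ R3-edge b a c
  R3-sym zero zero zero = refl
  R3-sym zero zero (suc zero) = refl
  R3-sym zero zero (suc (suc zero)) = refl
  R3-sym zero zero (suc (suc (suc zero))) = refl
  R3-sym zero (suc zero) zero = refl
  R3-sym zero (suc zero) (suc zero) = refl
  R3-sym zero (suc zero) (suc (suc zero)) = refl
  R3-sym zero (suc zero) (suc (suc (suc zero))) = refl
  R3-sym zero (suc (suc zero)) zero = refl
  R3-sym zero (suc (suc zero)) (suc zero) = refl
  R3-sym zero (suc (suc zero)) (suc (suc zero)) = refl
  R3-sym zero (suc (suc zero)) (suc (suc (suc zero))) = refl
  R3-sym zero (suc (suc (suc zero))) zero = refl
  R3-sym zero (suc (suc (suc zero))) (suc zero) = refl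
  R3-sym zero (suc (suc (suc zero))) (suc (suc zero)) = refl
  R3-sym zero (suc (suc (suc zero))) (suc (suc (suc zero))) = refl
  R3-sym (suc zero) zero zero = refl
  R3-sym (suc zero) zero (suc zero) = refl
  R3-sym (suc zero) zero (suc (suc zero)) = refl
  R3-sym (suc zero) zero (suc (suc (suc zero))) = refl
  R3-sym (suc zero) (suc zero) zero = refl
  R3-sym (suc zero) (suc zero) (suc zero) = refl
  R3-sym (suc zero) (suc zero) (suc (suc zero)) = refl
  R3-sym (suc zero) (suc zero) (suc (suc (suc zero))) = refl
  R3-sym (suc zero) (suc (suc zero)) zero = refl
  R3-sym (suc zero) (suc (suc zero)) (suc zero) = refl
  R3-sym (suc zero) (suc (suc zero)) (suc (suc zero)) = refl
  R3-sym (suc zero) (suc (suc zero)) (suc (suc (suc zero))) = refl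
  R3-sym (suc zero) (suc (suc (suc zero))) zero = refl
  R3-sym (suc zero) (suc (suc (suc zero))) (suc zero) = refl
  R3-sym (suc zero) (suc (suc (suc zero))) (suc (suc zero)) = refl
  R3-sym (suc zero) (suc (suc (suc zero))) (suc (suc (suc zero))) = refl
  R3-sym (suc (suc zero)) zero zero = refl
  R3-sym (suc (suc zero)) zero (suc zero) = refl
  R3-sym (suc (suc zero)) zero (suc (suc zero)) = refl
  R3-sym (suc (suc zero)) zero (suc (suc (suc zero))) = refl
  R3-sym (suc (suc zero)) (suc zero) zero = refl
  R3-sym (suc (suc zero)) (suc zero) (suc zero) = refl
  R3-sym (suc (suc zero)) (suc zero) (suc (suc zero)) = refl
  R3-sym (suc (suc zero)) (suc zero) (suc (suc (suc zero))) = refl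
  R3-sym (suc (suc zero)) (suc (suc zero)) zero = refl
  R3-sym (suc (suc zero)) (suc (suc zero)) (suc zero) = refl
  R3-sym (suc (suc zero)) (suc (suc zero)) (suc (suc zero)) = refl
  R3-sym (suc (suc zero)) (suc (suc zero)) (suc (suc (suc zero))) = refl
  R3-sym (suc (suc zero)) (suc (suc (suc zero))) zero = refl
  R3-sym (suc (suc zero)) (suc (suc (suc zero))) (suc zero) = refl
  R3-sym (suc (suc zero)) (suc (suc (suc zero))) (suc (suc zero)) = refl
  R3-sym (suc (suc zero)) (suc (suc (suc zero))) (suc (suc (suc zero))) = refl
  R3-sym (suc (suc (suc zero))) zero zero = refl
  R3-sym (suc (suc (suc zero))) zero (suc zero) = refl
  R3-sym (suc (suc (suc zero))) zero (suc (suc zero)) = refl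
  R3-sym (suc (suc (suc zero))) zero (suc (suc (suc zero))) = refl
  R3-sym (suc (suc (suc zero))) (suc zero) zero = refl
  R3-sym (suc (suc (suc zero))) (suc zero) (suc zero) = refl
  R3-sym (suc (suc (suc zero))) (suc zero) (suc (suc zero)) = refl
  R3-sym (suc (suc (suc zero))) (suc zero) (suc (suc (suc zero))) = refl
  R3-sym (suc (suc (suc zero))) (suc (suc zero)) zero = refl
  R3-sym (suc (suc (suc zero))) (suc (suc zero)) (suc zero) = refl
  R3-sym (suc (suc (suc zero))) (suc (suc zero)) (suc (suc zero)) = refl
  R3-sym (suc (suc (suc zero))) (suc (suc zero)) (suc (suc (suc zero))) = refl
  R3-sym (suc (suc (suc zero))) (suc (suc (suc zero))) zero = refl
  R3-sym (suc (suc (suc zero))) (suc (suc (suc zero))) (suc zero) = refl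
  R3-sym (suc (suc (suc zero))) (suc (suc (suc zero))) (suc (suc zero)) = refl
  R3-sym (suc (suc (suc zero))) (suc (suc (suc zero))) (suc (suc (suc zero))) = refl
  R3-loopless : ∀ a b c → R3-edge a b c ≡ true → (a ≢ b) × (a ≢ c) × (b ≢ c)
  R3-loopless zero zero zero ()
  R3-loopless zero zero (suc zero) ()
  R3-loopless zero zero (suc (suc zero)) ()
  R3-loopless zero zero (suc (suc (suc zero))) ()
  R3-loopless zero (suc zero) zero ()
  R3-loopless zero (suc zero) (suc zero) ()
  R3-loopless zero (suc zero) (suc (suc zero)) refl = (λ ()) , (λ ()) , (λ ())
  R3-loopless zero (suc zero) (suc (suc (suc zero))) ()
  R3-loopless zero (suc (suc zero)) zero ()
  R3-loopless zero (suc (suc zero)) (suc zero) ()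
  R3-loopless zero (suc (suc zero)) (suc (suc zero)) ()
  R3-loopless zero (suc (suc zero)) (suc (suc (suc zero))) ()
  R3-loopless zero (suc (suc (suc zero))) zero ()
  R3-loopless zero (suc (suc (suc zero))) (suc zero) ()
  R3-loopless zero (suc (suc (suc zero))) (suc (suc zero)) ()
  R3-loopless zero (suc (suc (suc zero))) (suc (suc (suc zero))) ()
  R3-loopless (suc zero) zero zero ()
  R3-loopless (suc zero) zero (suc zero) ()
  R3-loopless (suc zero) zero (suc (suc zero)) refl = (λ ()) , (λ ()) , (λ ())
  R3-loopless (suc zero) zero (suc (suc (suc zero))) ()
  R3-loopless (suc zero) (suc zero) zero ()
  R3-loopless (suc zero) (suc zero) (suc zero) ()
  R3-loopless (suc zero) (suc zero) (suc (suc zero)) ()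
  R3-loopless (suc zero) (suc zero) (suc (suc (suc zero))) ()
  R3-loopless (suc zero) (suc (suc zero)) zero ()
  R3-loopless (suc zero) (suc (suc zero)) (suc zero) ()
  R3-loopless (suc zero) (suc (suc zero)) (suc (suc zero)) ()
  R3-loopless (suc zero) (suc (suc zero)) (suc (suc (suc zero))) refl = (λ ()) , (λ ()) , (λ ())
  R3-loopless (suc zero) (suc (suc (suc zero))) zero ()
  R3-loopless (suc zero) (suc (suc (suc zero))) (suc zero) ()
  R3-loopless (suc zero) (suc (suc (suc zero))) (suc (suc zero)) ()
  R3-loopless (suc zero) (suc (suc (suc zero))) (suc (suc (suc zero))) ()
  R3-loopless (suc (suc zero)) zero zero ()
  R3-loopless (suc (suc zero)) zero (suc zero) ()
  R3-loopless (suc (suc zero)) zero (suc (suc zero)) ()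
  R3-loopless (suc (suc zero)) zero (suc (suc (suc zero))) ()
  R3-loopless (suc (suc zero)) (suc zero) zero ()
  R3-loopless (suc (suc zero)) (suc zero) (suc zero) ()
  R3-loopless (suc (suc zero)) (suc zero) (suc (suc zero)) ()
  R3-loopless (suc (suc zero)) (suc zero) (suc (suc (suc zero))) refl = (λ ()) , (λ ()) , (λ ())
  R3-loopless (suc (suc zero)) (suc (suc zero)) zero ()
  R3-loopless (suc (suc zero)) (suc (suc zero)) (suc zero) ()
  R3-loopless (suc (suc zero)) (suc (suc zero)) (suc (suc zero)) ()
  R3-loopless (suc (suc zero)) (suc (suc zero)) (suc (suc (suc zero))) ()
  R3-loopless (suc (suc zero)) (suc (suc (suc zero))) zero ()
  R3-loopless (suc (suc zero)) (suc (suc (suc zero))) (suc zero) ()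
  R3-loopless (suc (suc zero)) (suc (suc (suc zero))) (suc (suc zero)) ()
  R3-loopless (suc (suc zero)) (suc (suc (suc zero))) (suc (suc (suc zero))) ()
  R3-loopless (suc (suc (suc zero))) zero zero ()
  R3-loopless (suc (suc (suc zero))) zero (suc zero) ()
  R3-loopless (suc (suc (suc zero))) zero (suc (suc zero)) ()
  R3-loopless (suc (suc (suc zero))) zero (suc (suc (suc zero))) ()
  R3-loopless (suc (suc (suc zero))) (suc zero) zero ()
  R3-loopless (suc (suc (suc zero))) (suc zero) (suc zero) ()
  R3-loopless (suc (suc (suc zero))) (suc zero) (suc (suc zero)) ()
  R3-loopless (suc (suc (suc zero))) (suc zero) (suc (suc (suc zero))) ()
  R3-loopless (suc (suc (suc zero))) (suc (suc zero)) zero ()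
  R3-loopless (suc (suc (suc zero))) (suc (suc zero)) (suc zero) ()
  R3-loopless (suc (suc (suc zero))) (suc (suc zero)) (suc (suc zero)) ()
  R3-loopless (suc (suc (suc zero))) (suc (suc zero)) (suc (suc (suc zero))) ()
  R3-loopless (suc (suc (suc zero))) (suc (suc (suc zero))) zero ()
  R3-loopless (suc (suc (suc zero))) (suc (suc (suc zero))) (suc zero) ()
  R3-loopless (suc (suc (suc zero))) (suc (suc (suc zero))) (suc (suc zero)) ()
  R3-loopless (suc (suc (suc zero))) (suc (suc (suc zero))) (suc (suc (suc zero))) ()

R3 : Graph 4
R3 = record { edge = R3-edge ; sym = R3-sym ; loopless = R3-loopless }

-- ⌊n/2⌋ ⌈n/2⌉ (n-2)/2  (always an integer, so ℕ-division by 2 is exact)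
exValue : ℕ → ℕ
exValue n = (⌊ n /2⌋ * ⌈ n /2⌉ * (n ∸ 2)) / 2

-- Fix a vertex a of an R₃-free graph G and sort every other vertex b by the codegree of
-- the pair ab (the number of heads c with ab → c): dense (≥ 2), single (= 1) or empty (0);
-- d, l, z count them, so d + l + z = n − 1.  Key lemma: if ab has two heads c ≠ c′, then
-- ac has no head at all, since any head would complete a copy of R₃.  Hence each dense pair
-- at a has at most z heads, and the local degree deg a = Σ_b codeg(a, b) is at most
-- z d + l ≤ ⌊(n − 1)²/4⌋.  As Σ_a deg a = 2 e(G), this is the bound for even n.  For odd
-- n = 2h + 1 it is h too weak; but the vertices with deg = h² all lie in the "cluster"
-- {a} ∪ dense(a) of any one of them, which has h + 1 elements, and this recovers the loss.
-- In an extremal graph every local bound is tight: no pair is single, every vertex is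
-- saturated (each dense pair at a has all empty pairs at a as heads), and the empty pairs
-- are exactly those between a cluster and its complement.  So G is the bipartite graph
-- with edges ab → c for a, b on one side and c on the other, sides ⌈n/2⌉ and ⌊n/2⌋.
module Submission where

open import Defs hiding (sym)
open import Data.Bool as Bool using (Bool; true; false; not; _∧_; _∨_; _xor_; T; if_then_else_)
open import Data.Empty using (⊥; ⊥-elim)
open import Data.Fin as Fin using (Fin; zero; suc; toℕ)
import Data.Fin.Properties as Finₚ
open import Data.Fin.Patterns using (0F; 1F; 2F; 3F)
open import Data.List using (List; []; _∷_; length; filterᵇ; allFin; cartesianProduct; tabulate; map; _++_)
import Data.List.Properties as Listₚ
open import Data.Nat
open import Data.Nat.Properties
open import Data.Nat.DivMod using (m*n/n≡m)
open import Data.Nat.Tactic.RingSolver using (solve-∀)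
open import Data.Product using (Σ; ∃; _×_; _,_; proj₁; proj₂)
open import Data.Sum using (_⊎_; inj₁; inj₂)
open import Data.Unit using (tt)
open import Function using (_∘_)
open import Function.Definitions using (Injective; Surjective; Bijective)
open import Relation.Binary.Definitions using (tri<; tri≈; tri>)
open import Relation.Binary.PropositionalEquality
open import Relation.Nullary using (¬_; yes; no; does)
open import Data.Bool.Properties using (not-involutive; ∧-identityʳ; ∧-zeroʳ; xor-same)
open import Relation.Nullary.Decidable using (dec-true; dec-false; ¬?; _×-dec_)

open import Algebra.Properties.Semiring.Sum +-*-semiring
  using (sum; sum-cong-≗; ∑-distrib-+; ∑-comm; *-distribˡ-sum; *-distribʳ-sum)

⟦_⟧ : Bool → ℕ
⟦ true ⟧ = 1
⟦ false ⟧ = 0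

-- The library states sums of constants with monoid multiples; we need them with _*_.
sum-const : ∀ {n} (c : ℕ) → sum {n} (λ _ → c) ≡ n * c
sum-const {zero} c = refl
sum-const {suc n} c = cong (c +_) (sum-const {n} c)

sum-mono : ∀ {n} {f g : Fin n → ℕ} → (∀ i → f i ≤ g i) → sum f ≤ sum g
sum-mono {zero} f≤g = z≤n
sum-mono {suc n} f≤g = +-mono-≤ (f≤g zero) (sum-mono (f≤g ∘ suc))

sum-mono-< : ∀ {n} {f g : Fin n → ℕ} → (∀ i → f i ≤ g i) → ∀ j → f j < g j → sum f < sum g
sum-mono-< {suc n} f≤g zero fj<gj = +-mono-<-≤ fj<gj (sum-mono (f≤g ∘ suc))
sum-mono-< {suc n} f≤g (suc j) fj<gj = +-mono-≤-< (f≤g zero) (sum-mono-< (f≤g ∘ suc) j fj<gj)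

sum-tight : ∀ {n} {f g : Fin n → ℕ} → (∀ i → f i ≤ g i) → sum g ≤ sum f → ∀ i → f i ≡ g i
sum-tight f≤g Σg≤Σf i with m≤n⇒m<n∨m≡n (f≤g i)
... | inj₂ fi≡gi = fi≡gi
... | inj₁ fi<gi = ⊥-elim (<⇒≱ (sum-mono-< f≤g i fi<gi) Σg≤Σf)

term≤sum : ∀ {n} (f : Fin n → ℕ) (i : Fin n) → f i ≤ sum f
term≤sum f zero = m≤m+n _ _
term≤sum f (suc i) = ≤-trans (term≤sum (f ∘ suc) i) (m≤n+m _ _)

false≢true : false ≢ true
false≢true ()

bool-ext : ∀ {p q : Bool} → (p ≡ true → q ≡ true) → (q ≡ true → p ≡ true) → p ≡ q
bool-ext {true} p⇒q _ = sym (p⇒q refl)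
bool-ext {false} {false} _ _ = refl
bool-ext {false} {true} _ q⇒p = q⇒p refl

≢⇒xor : ∀ {x y : Bool} → x ≢ y → (x xor y) ≡ true
≢⇒xor {true} {true} x≢y = ⊥-elim (x≢y refl)
≢⇒xor {true} {false} _ = refl
≢⇒xor {false} {true} _ = refl
≢⇒xor {false} {false} x≢y = ⊥-elim (x≢y refl)

≡⇒xor : ∀ {x y : Bool} → x ≡ y → (x xor y) ≡ false
≡⇒xor {x} refl = xor-same x

<ᵇ-true : ∀ {x y} → x < y → (x <ᵇ y) ≡ true
<ᵇ-true {x} {y} = dec-true (x <? y)

<ᵇ-false : ∀ {x y} → ¬ x < y → (x <ᵇ y) ≡ false
<ᵇ-false {x} {y} = dec-false (x <? y)

<ᵇ-sound : ∀ {x y} → (x <ᵇ y) ≡ true → x < y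
<ᵇ-sound {x} {y} x<ᵇy = <ᵇ⇒< x y (subst T (sym x<ᵇy) tt)

_==_ : ∀ {n} → Fin n → Fin n → Bool
a == b = does (a Fin.≟ b)

==-refl : ∀ {n} (a : Fin n) → (a == a) ≡ true
==-refl a = dec-true (a Fin.≟ a) refl

==-≢ : ∀ {n} {a b : Fin n} → a ≢ b → (a == b) ≡ false
==-≢ {a = a} {b} = dec-false (a Fin.≟ b)

==-sound : ∀ {n} {a b : Fin n} → (a == b) ≡ true → a ≡ b
==-sound {a = a} {b} a==b with a Fin.≟ b
... | yes a≡b = a≡b

==-sym : ∀ {n} (a b : Fin n) → (a == b) ≡ (b == a)
==-sym a b with a Fin.≟ b
... | yes refl = sym (==-refl a)
... | no a≢b = sym (==-≢ (a≢b ∘ sym))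

count : ∀ {n} → (Fin n → Bool) → ℕ
count P = sum (λ i → ⟦ P i ⟧)

_⊆_ : ∀ {n} → (Fin n → Bool) → (Fin n → Bool) → Set
P ⊆ Q = ∀ i → P i ≡ true → Q i ≡ true

⟦⟧-mono : ∀ {p q : Bool} → (p ≡ true → q ≡ true) → ⟦ p ⟧ ≤ ⟦ q ⟧
⟦⟧-mono {false} p⇒q = z≤n
⟦⟧-mono {true} p⇒q rewrite p⇒q refl = ≤-refl

⟦⟧-injective : ∀ {p q : Bool} → ⟦ p ⟧ ≡ ⟦ q ⟧ → p ≡ q
⟦⟧-injective {true} {true} _ = refl
⟦⟧-injective {false} {false} _ = refl

⟦∧⟧ : ∀ x y → ⟦ x ∧ y ⟧ ≡ ⟦ x ⟧ * ⟦ y ⟧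
⟦∧⟧ true y = sym (+-identityʳ ⟦ y ⟧)
⟦∧⟧ false y = refl

⟦∧⟧≤ : ∀ p q → ⟦ p ∧ q ⟧ ≤ ⟦ p ⟧
⟦∧⟧≤ true true = ≤-refl
⟦∧⟧≤ true false = z≤n
⟦∧⟧≤ false q = z≤n

count-mono : ∀ {n} {P Q : Fin n → Bool} → P ⊆ Q → count P ≤ count Q
count-mono P⊆Q = sum-mono (λ i → ⟦⟧-mono (P⊆Q i))

⊆-count-≡ : ∀ {n} {P Q : Fin n → Bool} → P ⊆ Q → count Q ≤ count P → ∀ i → P i ≡ Q i
⊆-count-≡ P⊆Q #Q≤#P i = ⟦⟧-injective (sum-tight (λ j → ⟦⟧-mono (P⊆Q j)) #Q≤#P i)

count-pos : ∀ {n} (P : Fin n → Bool) → 1 ≤ count P → ∃ λ i → P i ≡ true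
count-pos {suc n} P 1≤#P with P zero in P0
... | true = zero , P0
... | false = let (i , Pi) = count-pos (P ∘ suc) 1≤#P in suc i , Pi

count-none : ∀ {n} (P : Fin n → Bool) → (∀ i → P i ≢ true) → count P ≡ 0
count-none {n} P never = n≤0⇒n≡0 (≤-trans (count-mono P⊆∅) (≤-reflexive (trans (sum-const {n} 0) (*-zeroʳ n))))
  where
  P⊆∅ : P ⊆ (λ _ → false)
  P⊆∅ i Pi = ⊥-elim (never i Pi)

count-zero : ∀ {n} (P : Fin n → Bool) → count P ≡ 0 → ∀ i → P i ≡ false
count-zero P #P≡0 i with P i in Pi
... | false = refl
... | true = ⊥-elim (<⇒≱ (≤-trans (≤-reflexive (cong ⟦_⟧ (sym Pi))) (term≤sum _ i)) (≤-reflexive #P≡0))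

count-∨ : ∀ {n} (P Q : Fin n → Bool) → (∀ i → P i ≡ true → Q i ≡ false) →
          count (λ i → P i ∨ Q i) ≡ count P + count Q
count-∨ P Q disjoint = trans (sum-cong-≗ pointwise) (∑-distrib-+ (λ i → ⟦ P i ⟧) (λ i → ⟦ Q i ⟧))
  where
  pointwise : ∀ i → ⟦ P i ∨ Q i ⟧ ≡ ⟦ P i ⟧ + ⟦ Q i ⟧
  pointwise i with P i in Pi
  ... | true rewrite disjoint i Pi = refl
  ... | false = refl

count-compl : ∀ {n} (P : Fin n → Bool) → count P + count (not ∘ P) ≡ n
count-compl {n} P = begin
  count P + count (not ∘ P)           ≡⟨ ∑-distrib-+ (λ i → ⟦ P i ⟧) (λ i → ⟦ not (P i) ⟧) ⟨
  sum (λ i → ⟦ P i ⟧ + ⟦ not (P i) ⟧) ≡⟨ sum-cong-≗ (λ i → one (P i)) ⟩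
  sum {n} (λ _ → 1)                   ≡⟨ sum-const {n} 1 ⟩
  n * 1                               ≡⟨ *-identityʳ n ⟩
  n                                   ∎
  where
  open ≡-Reasoning
  one : ∀ b → ⟦ b ⟧ + ⟦ not b ⟧ ≡ 1
  one true = refl
  one false = refl

sum-by-colour : ∀ {n} (A : Fin n → Bool) (g : Bool → ℕ) →
                sum (λ a → g (A a)) ≡ count A * g true + count (not ∘ A) * g false
sum-by-colour A g = begin
  sum (λ a → g (A a))
    ≡⟨ sum-cong-≗ (λ a → split (A a)) ⟩
  sum (λ a → ⟦ A a ⟧ * g true + ⟦ not (A a) ⟧ * g false)
    ≡⟨ ∑-distrib-+ (λ a → ⟦ A a ⟧ * g true) (λ a → ⟦ not (A a) ⟧ * g false) ⟩
  sum (λ a → ⟦ A a ⟧ * g true) + sum (λ a → ⟦ not (A a) ⟧ * g false)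
    ≡⟨ cong₂ _+_ (*-distribʳ-sum (g true) (λ a → ⟦ A a ⟧)) (*-distribʳ-sum (g false) (λ a → ⟦ not (A a) ⟧)) ⟨
  count A * g true + count (not ∘ A) * g false ∎
  where
  open ≡-Reasoning
  split : ∀ b → g b ≡ ⟦ b ⟧ * g true + ⟦ not b ⟧ * g false
  split true = sym (trans (+-identityʳ _) (+-identityʳ _))
  split false = sym (+-identityʳ _)

count-singleton : ∀ {n} (a : Fin n) → count (a ==_) ≡ 1
count-singleton {suc n} zero = cong suc (trans (sum-const {n} 0) (*-zeroʳ n))
count-singleton {suc n} (suc a) = count-singleton a

another-witness : ∀ {n} (P : Fin n → Bool) {c : Fin n} → 2 ≤ count P → P c ≡ true →
                  ∃ λ c′ → c′ ≢ c × P c′ ≡ true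
another-witness P {c} 2≤#P Pc
  with Finₚ.any? (λ c′ → ¬? (c′ Fin.≟ c) ×-dec (P c′ Bool.≟ true))
... | yes witness = witness
... | no none = ⊥-elim (<⇒≱ 2≤#P (≤-trans (count-mono P⊆c) (≤-reflexive (count-singleton c))))
  where
  P⊆c : P ⊆ (c ==_)
  P⊆c i Pi with i Fin.≟ c
  ... | yes refl = ==-refl c
  ... | no i≢c = ⊥-elim (none (i , i≢c , Pi))

-- Double counting of edges.

countList : ∀ {A : Set} → (A → Bool) → List A → ℕ
countList P xs = length (filterᵇ P xs)

countList-∷ : ∀ {A : Set} (P : A → Bool) x xs → countList P (x ∷ xs) ≡ ⟦ P x ⟧ + countList P xs
countList-∷ P x xs with P x
... | true = refl
... | false = refl

countList-++ : ∀ {A : Set} (P : A → Bool) xs ys → countList P (xs ++ ys) ≡ countList P xs + countList P ys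
countList-++ P xs ys =
  trans (cong length (Listₚ.filter-++ (Bool.T? ∘ P) xs ys)) (Listₚ.length-++ (filterᵇ P xs))

countList-map : ∀ {A B : Set} (P : B → Bool) (f : A → B) xs → countList P (map f xs) ≡ countList (P ∘ f) xs
countList-map P f [] = refl
countList-map P f (x ∷ xs) = begin
  countList P (f x ∷ map f xs)      ≡⟨ countList-∷ P (f x) (map f xs) ⟩
  ⟦ P (f x) ⟧ + countList P (map f xs) ≡⟨ cong (⟦ P (f x) ⟧ +_) (countList-map P f xs) ⟩
  ⟦ P (f x) ⟧ + countList (P ∘ f) xs ≡⟨ countList-∷ (P ∘ f) x xs ⟨
  countList (P ∘ f) (x ∷ xs)        ∎
  where open ≡-Reasoning

countList-tabulate : ∀ {A : Set} {n} (P : A → Bool) (f : Fin n → A) → countList P (tabulate f) ≡ count (P ∘ f)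
countList-tabulate {n = zero} P f = refl
countList-tabulate {n = suc n} P f =
  trans (countList-∷ P (f zero) (tabulate (f ∘ suc))) (cong (⟦ P (f zero) ⟧ +_) (countList-tabulate P (f ∘ suc)))

countList-product : ∀ {A B : Set} {n} (P : A × B → Bool) (f : Fin n → A) (ys : List B) →
  countList P (cartesianProduct (tabulate f) ys) ≡ sum (λ i → countList (λ y → P (f i , y)) ys)
countList-product {n = zero} P f ys = refl
countList-product {n = suc n} P f ys =
  trans (countList-++ P (map (f zero ,_) ys) _)
        (cong₂ _+_ (countList-map P (f zero ,_) ys) (countList-product P (f ∘ suc) ys))

codeg : ∀ {n} → Graph n → Fin n → Fin n → ℕ
codeg G a b = count (edge G a b)

edgeCount-sum : ∀ {n} (G : Graph n) →
  edgeCount G ≡ sum (λ a → sum (λ b → count (λ c → (toℕ a <ᵇ toℕ b) ∧ edge G a b c)))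
edgeCount-sum {n} G =
  trans (countList-product P (λ a → a) (cartesianProduct (allFin n) (allFin n)))
        (sum-cong-≗ (λ a → trans (countList-product (λ y → P (a , y)) (λ b → b) (allFin n))
                                 (sum-cong-≗ (λ b → countList-tabulate (λ c → P (a , b , c)) (λ c → c)))))
  where
  P : Fin n × Fin n × Fin n → Bool
  P (a , b , c) = (toℕ a <ᵇ toℕ b) ∧ edge G a b c

no-edge-on-diagonal : ∀ {n} (G : Graph n) {a b} c → a ≡ b → edge G a b c ≡ false
no-edge-on-diagonal G {a} c refl with edge G a a c in e
... | false = refl
... | true = ⊥-elim (proj₁ (loopless G a a c e) refl)

edge-orders : ∀ {n} (G : Graph n) a b c →
  ⟦ edge G a b c ⟧ ≡ ⟦ (toℕ a <ᵇ toℕ b) ∧ edge G a b c ⟧ + ⟦ (toℕ b <ᵇ toℕ a) ∧ edge G b a c ⟧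
edge-orders G a b c with <-cmp (toℕ a) (toℕ b)
... | tri< a<b _ b≮a rewrite <ᵇ-true a<b | <ᵇ-false b≮a = sym (+-identityʳ _)
... | tri> a≮b _ b<a rewrite <ᵇ-true b<a | <ᵇ-false a≮b | Graph.sym G a b c = refl
... | tri≈ a≮b a≡b b≮a rewrite <ᵇ-false a≮b | <ᵇ-false b≮a =
  cong ⟦_⟧ (no-edge-on-diagonal G c (Finₚ.toℕ-injective a≡b))

codeg-sum : ∀ {n} (G : Graph n) → sum (λ a → sum (λ b → codeg G a b)) ≡ 2 * edgeCount G
codeg-sum {n} G = begin
  sum (λ a → sum (λ b → codeg G a b))
    ≡⟨ sum-cong-≗ (λ a → sum-cong-≗ (λ b →
         trans (sum-cong-≗ (edge-orders G a b)) (∑-distrib-+ (ordered a b) (ordered b a)))) ⟩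
  sum (λ a → sum (λ b → X a b + X b a))
    ≡⟨ sum-cong-≗ (λ a → ∑-distrib-+ (X a) (λ b → X b a)) ⟩
  sum (λ a → sum (X a) + sum (λ b → X b a))
    ≡⟨ ∑-distrib-+ (λ a → sum (X a)) (λ a → sum (λ b → X b a)) ⟩
  E + sum (λ a → sum (λ b → X b a))
    ≡⟨ cong (E +_) (∑-comm (λ a b → X b a)) ⟩
  E + E
    ≡⟨ cong (λ m → m + m) (edgeCount-sum G) ⟨
  edgeCount G + edgeCount G
    ≡⟨ cong (edgeCount G +_) (+-identityʳ _) ⟨
  2 * edgeCount G ∎
  where
  open ≡-Reasoning
  ordered : Fin n → Fin n → Fin n → ℕ
  ordered a b c = ⟦ (toℕ a <ᵇ toℕ b) ∧ edge G a b c ⟧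
  X : Fin n → Fin n → ℕ
  X a b = sum (ordered a b)
  E : ℕ
  E = sum (λ a → sum (X a))

-- The bipartite construction.

-- For a colouring A of the vertices, a and b are partners if they are of the same
-- colour and distinct; the bipartite graph has the edges ab → c with a, b partners and c
-- of the other colour.
partners : ∀ {n} → (Fin n → Bool) → Fin n → Fin n → Bool
partners A a b = not (A a xor A b) ∧ not (a == b)

bipartite-edge : ∀ {n} → (Fin n → Bool) → Fin n → Fin n → Fin n → Bool
bipartite-edge A a b c = partners A a b ∧ (A a xor A c)

bipartite-parts : ∀ x y w t → (not (x xor y) ∧ not t) ∧ (x xor w) ≡ true → t ≡ false × x ≡ y × x ≢ w
bipartite-parts true true false false _ = refl , refl , λ ()
bipartite-parts false false true false _ = refl , refl , λ ()
bipartite-parts true false _ _ ()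
bipartite-parts false true _ _ ()
bipartite-parts true true _ true ()
bipartite-parts false false _ true ()
bipartite-parts true true true false ()
bipartite-parts false false false false ()

bipartite-edge-true : ∀ {n} (A : Fin n → Bool) {a b c} → bipartite-edge A a b c ≡ true →
                      a ≢ b × A a ≡ A b × A a ≢ A c
bipartite-edge-true A {a} {b} {c} e with bipartite-parts (A a) (A b) (A c) (a == b) e
... | a==b-false , same , different =
  (λ { refl → false≢true (trans (sym a==b-false) (==-refl a)) }) , same , different

bipartite : ∀ {n} → (Fin n → Bool) → Graph n
bipartite A = record { edge = bipartite-edge A ; sym = bip-sym ; loopless = bip-loopless }
  where
  bip-sym : ∀ a b c → bipartite-edge A a b c ≡ bipartite-edge A b a c
  bip-sym a b c rewrite ==-sym a b with A a | A b
  ... | true | true = refl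
  ... | true | false = refl
  ... | false | true = refl
  ... | false | false = refl
  bip-loopless : ∀ a b c → bipartite-edge A a b c ≡ true → a ≢ b × a ≢ c × b ≢ c
  bip-loopless a b c e with a≢b , Aa≡Ab , Aa≢Ac ← bipartite-edge-true A e =
    a≢b , (λ a≡c → Aa≢Ac (cong A a≡c)) , (λ b≡c → Aa≢Ac (trans Aa≡Ab (cong A b≡c)))

opposite : ∀ {n} → (Fin n → Bool) → Fin n → ℕ
opposite A a = count (λ c → A a xor A c)

opposite-true : ∀ {n} (A : Fin n → Bool) {a} → A a ≡ true → opposite A a ≡ count (not ∘ A)
opposite-true A Aa = sum-cong-≗ (λ c → cong (λ v → ⟦ v xor A c ⟧) Aa)

opposite-false : ∀ {n} (A : Fin n → Bool) {a} → A a ≡ false → opposite A a ≡ count A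
opposite-false A Aa = sum-cong-≗ (λ c → cong (λ v → ⟦ v xor A c ⟧) Aa)

bipartite-codeg : ∀ {n} (A : Fin n → Bool) a b → codeg (bipartite A) a b ≡ ⟦ partners A a b ⟧ * opposite A a
bipartite-codeg A a b =
  trans (sum-cong-≗ (λ c → ⟦∧⟧ (partners A a b) (A a xor A c)))
        (sym (*-distribˡ-sum ⟦ partners A a b ⟧ (λ c → ⟦ A a xor A c ⟧)))

partners-count : ∀ {n} (A : Fin n → Bool) a → suc (count (partners A a)) ≡ count (λ b → not (A a xor A b))
partners-count A a = begin
  suc (count (partners A a))                  ≡⟨ cong (_+ count (partners A a)) (count-singleton a) ⟨
  count (a ==_) + count (partners A a)        ≡⟨ count-∨ (a ==_) (partners A a) not-partner ⟨
  count (λ b → (a == b) ∨ partners A a b)     ≡⟨ sum-cong-≗ (λ b → cong ⟦_⟧ (same-colour b)) ⟩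
  count (λ b → not (A a xor A b))             ∎
  where
  open ≡-Reasoning
  not-partner : ∀ b → (a == b) ≡ true → partners A a b ≡ false
  not-partner b a==b rewrite a==b = ∧-zeroʳ _
  same-colour : ∀ b → ((a == b) ∨ partners A a b) ≡ not (A a xor A b)
  same-colour b with a Fin.≟ b
  ... | yes refl = sym (cong not (xor-same (A a)))
  ... | no _ = ∧-identityʳ _

-- With colour classes of sizes p + 1 and q + 1, twice the number of edges is
-- (p + 1) · p (q + 1) + (q + 1) · q (p + 1): each vertex has p resp. q partners,
-- and each partner pair has q + 1 resp. p + 1 heads.
bipartite-edge-count : ∀ {n} (A : Fin n → Bool) {p q} → count A ≡ suc p → count (not ∘ A) ≡ suc q →
                       2 * edgeCount (bipartite A) ≡ suc p * (p * suc q) + suc q * (q * suc p)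
bipartite-edge-count A {p} {q} #A #Ā = begin
  2 * edgeCount (bipartite A)
    ≡⟨ codeg-sum (bipartite A) ⟨
  sum (λ a → sum (λ b → codeg (bipartite A) a b))
    ≡⟨ sum-cong-≗ (λ a → trans (sum-cong-≗ (bipartite-codeg A a))
                               (sym (*-distribʳ-sum (opposite A a) (λ b → ⟦ partners A a b ⟧)))) ⟩
  sum (λ a → count (partners A a) * opposite A a)
    ≡⟨ sum-cong-≗ (λ a → by-colour a (A a) refl) ⟩
  sum (λ a → g (A a))
    ≡⟨ sum-by-colour A g ⟩
  count A * g true + count (not ∘ A) * g false
    ≡⟨ cong₂ (λ x y → x * g true + y * g false) #A #Ā ⟩
  suc p * (p * suc q) + suc q * (q * suc p) ∎
  where
  open ≡-Reasoning
  g : Bool → ℕ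
  g true = p * suc q
  g false = q * suc p
  own-colour : ∀ {a x} → A a ≡ x → count (λ b → not (A a xor A b)) ≡ count (λ b → not (x xor A b))
  own-colour Aa≡x = sum-cong-≗ (λ b → cong (λ y → ⟦ not (y xor A b) ⟧) Aa≡x)
  by-colour : ∀ a x → A a ≡ x → count (partners A a) * opposite A a ≡ g x
  by-colour a true Aa = cong₂ _*_
    (suc-injective (trans (partners-count A a)
      (trans (own-colour Aa) (trans (sum-cong-≗ (λ b → cong ⟦_⟧ (not-involutive (A b)))) #A))))
    (trans (opposite-true A Aa) #Ā)
  by-colour a false Aa = cong₂ _*_
    (suc-injective (trans (partners-count A a) (trans (own-colour Aa) #Ā)))
    (trans (opposite-false A Aa) #A)

-- An R₃ would need ab → c and bc → d, making a, b, c all of one colour while c differs from a.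
bipartite-free : ∀ {n} (A : Fin n → Bool) → Free R3 (bipartite A)
bipartite-free A (φ , _ , hom)
  with bipartite-edge-true A (hom 0F 1F 2F refl) | bipartite-edge-true A (hom 1F 2F 3F refl)
... | _ , A0≡A1 , A0≢A2 | _ , A1≡A2 , _ = A0≢A2 (trans A0≡A1 A1≡A2)

-- Isomorphisms between bipartite graphs.

injective⇒onto : ∀ {n} (f : Fin n → Fin n) → Injective _≡_ _≡_ f → ∀ y → ∃ λ x → f x ≡ y
injective⇒onto {zero} f f-inj ()
injective⇒onto {suc m} f f-inj y with Finₚ.any? (λ x → f x Fin.≟ y)
... | yes hit = hit
... | no miss with Finₚ.pigeonhole (n<1+n m) (λ x → Fin.punchOut {i = y} {j = f x} (λ y≡fx → miss (x , sym y≡fx)))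
...   | i , j , i<j , same =
  ⊥-elim (<-irrefl (cong toℕ (f-inj (Finₚ.punchOut-injective (λ y≡fi → miss (i , sym y≡fi))
                                                             (λ y≡fj → miss (j , sym y≡fj)) same))) i<j)

rank : ∀ {n} → (Fin n → Bool) → Fin n → ℕ
rank P x = count (λ y → P y ∧ (toℕ y <ᵇ toℕ x))

rank<count : ∀ {n} (P : Fin n → Bool) x → P x ≡ true → rank P x < count P
rank<count P x Px = sum-mono-< (λ y → ⟦∧⟧≤ (P y) _) x x-not-before-x
  where
  x-not-before-x : ⟦ P x ∧ (toℕ x <ᵇ toℕ x) ⟧ < ⟦ P x ⟧
  x-not-before-x rewrite Px | <ᵇ-false (<-irrefl (refl {x = toℕ x})) = s≤s z≤n

rank-mono : ∀ {n} (P : Fin n → Bool) x y → P x ≡ true → toℕ x < toℕ y → rank P x < rank P y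
rank-mono P x y Px x<y = sum-mono-< (λ w → ⟦⟧-mono (before-y w)) x x-counted
  where
  before-y : ∀ w → P w ∧ (toℕ w <ᵇ toℕ x) ≡ true → P w ∧ (toℕ w <ᵇ toℕ y) ≡ true
  before-y w h with P w
  ... | true = <ᵇ-true (<-trans (<ᵇ-sound h) x<y)
  x-counted : ⟦ P x ∧ (toℕ x <ᵇ toℕ x) ⟧ < ⟦ P x ∧ (toℕ x <ᵇ toℕ y) ⟧
  x-counted rewrite Px | <ᵇ-false (<-irrefl (refl {x = toℕ x})) | <ᵇ-true x<y = s≤s z≤n

rank-injective : ∀ {n} (P : Fin n → Bool) x y → P x ≡ true → P y ≡ true → rank P x ≡ rank P y → x ≡ y
rank-injective P x y Px Py same with <-cmp (toℕ x) (toℕ y)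
... | tri< x<y _ _ = ⊥-elim (<-irrefl same (rank-mono P x y Px x<y))
... | tri≈ _ x≡y _ = Finₚ.toℕ-injective x≡y
... | tri> _ _ y<x = ⊥-elim (<-irrefl (sym same) (rank-mono P y x Py y<x))

initial : ∀ {n} → ℕ → Fin n → Bool
initial p i = toℕ i <ᵇ p

count-initial : ∀ n p → p ≤ n → count {n} (initial p) ≡ p
count-initial zero zero _ = refl
count-initial (suc n) zero _ = count-none {suc n} (initial 0) (λ _ ())
count-initial (suc n) (suc p) (s≤s p≤n) = cong suc (count-initial n p p≤n)

-- Sorting the vertices, those of colour true first (each block in its order), is a
-- bijection turning the colouring A into the initial segment of length count A.
module Sort {n} (A : Fin n → Bool) where

  position : Fin n → ℕ
  position x = if A x then rank A x else count A + rank (not ∘ A) x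

  position-true : ∀ {x} → A x ≡ true → position x ≡ rank A x
  position-true Ax rewrite Ax = refl

  position-false : ∀ {x} → A x ≡ false → position x ≡ count A + rank (not ∘ A) x
  position-false Ax rewrite Ax = refl

  position<n : ∀ x → position x < n
  position<n x with A x in Ax
  ... | true = ≤-trans (rank<count A x Ax) (≤-trans (m≤m+n _ _) (≤-reflexive (count-compl A)))
  ... | false = ≤-trans (+-monoʳ-< (count A) (rank<count (not ∘ A) x (cong not Ax))) (≤-reflexive (count-compl A))

  sort : Fin n → Fin n
  sort x = Fin.fromℕ< (position<n x)

  toℕ-sort : ∀ x → toℕ (sort x) ≡ position x
  toℕ-sort x = Finₚ.toℕ-fromℕ< (position<n x)

  sort-colour : ∀ x → initial (count A) (sort x) ≡ A x
  sort-colour x rewrite toℕ-sort x with A x in Ax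
  ... | true = <ᵇ-true (rank<count A x Ax)
  ... | false = <ᵇ-false (≤⇒≯ (m≤m+n (count A) _))

  sort-injective : Injective _≡_ _≡_ sort
  sort-injective {x} {y} sx≡sy =
    same-position (A x) (A y) refl refl (trans (sym (toℕ-sort x)) (trans (cong toℕ sx≡sy) (toℕ-sort y)))
    where
    same-position : ∀ ax ay → A x ≡ ax → A y ≡ ay → position x ≡ position y → x ≡ y
    same-position true true Ax Ay eq =
      rank-injective A x y Ax Ay (trans (sym (position-true Ax)) (trans eq (position-true Ay)))
    same-position false false Ax Ay eq =
      rank-injective (not ∘ A) x y (cong not Ax) (cong not Ay)
        (+-cancelˡ-≡ (count A) _ _ (trans (sym (position-false Ax)) (trans eq (position-false Ay))))
    same-position true false Ax Ay eq = ⊥-elim (<⇒≱ (rank<count A x Ax)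
      (≤-trans (m≤m+n _ _) (≤-reflexive (sym (trans (sym (position-true Ax)) (trans eq (position-false Ay)))))))
    same-position false true Ax Ay eq = ⊥-elim (<⇒≱ (rank<count A y Ay)
      (≤-trans (m≤m+n _ _) (≤-reflexive (trans (sym (position-false Ax)) (trans eq (position-true Ay))))))

recolouring : ∀ {n} (A B : Fin n → Bool) → count A ≡ count B →
              Σ (Fin n → Fin n) λ φ → Bijective _≡_ _≡_ φ × (∀ x → B (φ x) ≡ A x)
recolouring {n} A B #A≡#B = φ , (φ-injective , φ-onto) , φ-colour
  where
  module SA = Sort A
  module SB = Sort B
  unsortB : Fin n → Fin n
  unsortB y = proj₁ (injective⇒onto SB.sort SB.sort-injective y)
  sort-unsort : ∀ y → SB.sort (unsortB y) ≡ y
  sort-unsort y = proj₂ (injective⇒onto SB.sort SB.sort-injective y)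
  φ : Fin n → Fin n
  φ x = unsortB (SA.sort x)
  φ-injective : Injective _≡_ _≡_ φ
  φ-injective {x} {y} φx≡φy =
    SA.sort-injective (trans (sym (sort-unsort (SA.sort x))) (trans (cong SB.sort φx≡φy) (sort-unsort (SA.sort y))))
  φ-onto : Surjective _≡_ _≡_ φ
  φ-onto y with x , φx≡y ← injective⇒onto φ φ-injective y = x , λ { refl → φx≡y }
  φ-colour : ∀ x → B (φ x) ≡ A x
  φ-colour x = begin
    B (φ x)                                ≡⟨ SB.sort-colour (φ x) ⟨
    initial (count B) (SB.sort (φ x))      ≡⟨ cong (initial (count B)) (sort-unsort (SA.sort x)) ⟩
    initial (count B) (SA.sort x)          ≡⟨ cong (λ c → initial c (SA.sort x)) #A≡#B ⟨
    initial (count A) (SA.sort x)          ≡⟨ SA.sort-colour x ⟩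
    A x                                    ∎
    where open ≡-Reasoning

IsBipartite : ∀ {n} → Graph n → (Fin n → Bool) → Set
IsBipartite G A = ∀ a b c → edge G a b c ≡ bipartite-edge A a b c

recoloured-edge : ∀ {n} {A B : Fin n → Bool} (φ : Fin n → Fin n) → Injective _≡_ _≡_ φ → (∀ x → B (φ x) ≡ A x) →
                  ∀ a b c → bipartite-edge A a b c ≡ bipartite-edge B (φ a) (φ b) (φ c)
recoloured-edge {A = A} {B} φ φ-injective φ-colour a b c = begin
  (not (A a xor A b) ∧ not (a == b)) ∧ (A a xor A c)
    ≡⟨ cong (λ t → (not (A a xor A b) ∧ not t) ∧ (A a xor A c)) (sym φ-preserves-==) ⟩
  (not (A a xor A b) ∧ not (φ a == φ b)) ∧ (A a xor A c)
    ≡⟨ cong₂ (λ x y → (not (x xor y) ∧ not (φ a == φ b)) ∧ (x xor A c)) (sym (φ-colour a)) (sym (φ-colour b)) ⟩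
  (not (B (φ a) xor B (φ b)) ∧ not (φ a == φ b)) ∧ (B (φ a) xor A c)
    ≡⟨ cong (λ w → (not (B (φ a) xor B (φ b)) ∧ not (φ a == φ b)) ∧ (B (φ a) xor w)) (sym (φ-colour c)) ⟩
  (not (B (φ a) xor B (φ b)) ∧ not (φ a == φ b)) ∧ (B (φ a) xor B (φ c)) ∎
  where
  open ≡-Reasoning
  φ-preserves-== : (φ a == φ b) ≡ (a == b)
  φ-preserves-== with a Fin.≟ b
  ... | yes refl = ==-refl (φ a)
  ... | no a≢b = ==-≢ (λ φa≡φb → a≢b (φ-injective φa≡φb))

bipartite-≅ : ∀ {n} (G H : Graph n) {A B : Fin n → Bool} → IsBipartite G A → IsBipartite H B →
              count A ≡ count B → G ≅ H
bipartite-≅ G H {A} {B} G≡A H≡B #A≡#B with φ , φ-bij , φ-colour ← recolouring A B #A≡#B =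
  φ , φ-bij , λ a b c → trans (G≡A a b c) (trans (recoloured-edge {A = A} {B} φ (proj₁ φ-bij) φ-colour a b c)
                                                  (sym (H≡B (φ a) (φ b) (φ c))))

-- The local structure of R₃-free graphs.

edge-swap : ∀ {n} (G : Graph n) {a b c} → edge G a b c ≡ true → edge G b a c ≡ true
edge-swap G {a} {b} {c} e = trans (Graph.sym G b a c) e

-- An R₃-free graph has no two edges pq → r and qr → s with s ≠ p: the other distinctness
-- conditions hold automatically, so p, q, r, s would span a copy of R₃.
no-R3-chain : ∀ {n} (G : Graph n) → Free R3 G → ∀ {p q r s} →
  edge G p q r ≡ true → edge G q r s ≡ true → s ≢ p → ⊥
no-R3-chain {n} G free {p} {q} {r} {s} pq→r qr→s s≢p = free (φ , φ-injective , φ-hom)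
  where
  p≢q : p ≢ q
  p≢q = proj₁ (loopless G p q r pq→r)
  p≢r : p ≢ r
  p≢r = proj₁ (proj₂ (loopless G p q r pq→r))
  q≢r : q ≢ r
  q≢r = proj₂ (proj₂ (loopless G p q r pq→r))
  q≢s : q ≢ s
  q≢s = proj₁ (proj₂ (loopless G q r s qr→s))
  r≢s : r ≢ s
  r≢s = proj₂ (proj₂ (loopless G q r s qr→s))
  φ : Fin 4 → Fin n
  φ 0F = p
  φ 1F = q
  φ 2F = r
  φ 3F = s
  φ-injective : Injective _≡_ _≡_ φ
  φ-injective {0F} {0F} _ = refl
  φ-injective {0F} {1F} eq = ⊥-elim (p≢q eq)
  φ-injective {0F} {2F} eq = ⊥-elim (p≢r eq)
  φ-injective {0F} {3F} eq = ⊥-elim (s≢p (sym eq))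
  φ-injective {1F} {0F} eq = ⊥-elim (p≢q (sym eq))
  φ-injective {1F} {1F} _ = refl
  φ-injective {1F} {2F} eq = ⊥-elim (q≢r eq)
  φ-injective {1F} {3F} eq = ⊥-elim (q≢s eq)
  φ-injective {2F} {0F} eq = ⊥-elim (p≢r (sym eq))
  φ-injective {2F} {1F} eq = ⊥-elim (q≢r (sym eq))
  φ-injective {2F} {2F} _ = refl
  φ-injective {2F} {3F} eq = ⊥-elim (r≢s eq)
  φ-injective {3F} {0F} eq = ⊥-elim (s≢p eq)
  φ-injective {3F} {1F} eq = ⊥-elim (q≢s (sym eq))
  φ-injective {3F} {2F} eq = ⊥-elim (r≢s (sym eq))
  φ-injective {3F} {3F} _ = refl
  φ-hom : IsHom R3 G φ
  φ-hom 0F 1F 2F _ = pq→r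
  φ-hom 1F 0F 2F _ = edge-swap G pq→r
  φ-hom 1F 2F 3F _ = qr→s
  φ-hom 2F 1F 3F _ = edge-swap G qr→s
  φ-hom 0F 0F _ ()
  φ-hom 0F 1F 0F ()
  φ-hom 0F 1F 1F ()
  φ-hom 0F 1F 3F ()
  φ-hom 0F 2F _ ()
  φ-hom 0F 3F _ ()
  φ-hom 1F 0F 0F ()
  φ-hom 1F 0F 1F ()
  φ-hom 1F 0F 3F ()
  φ-hom 1F 1F _ ()
  φ-hom 1F 2F 0F ()
  φ-hom 1F 2F 1F ()
  φ-hom 1F 2F 2F ()
  φ-hom 1F 3F _ ()
  φ-hom 2F 0F _ ()
  φ-hom 2F 1F 0F ()
  φ-hom 2F 1F 1F ()
  φ-hom 2F 1F 2F ()
  φ-hom 2F 2F _ ()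
  φ-hom 2F 3F _ ()
  φ-hom 3F _ _ ()

-- Key lemma: if the pair ab has two distinct heads c and c′, then the pair ac has no head.
-- (A head x = b would give the chain ca → b, ab → c′; any other x the chain ba → c, ac → x.)
two-heads-block : ∀ {n} (G : Graph n) → Free R3 G → ∀ {a b c c′ x} →
  edge G a b c ≡ true → edge G a b c′ ≡ true → c′ ≢ c → edge G a c x ≡ true → ⊥
two-heads-block G free {a} {b} {c} {c′} {x} ab→c ab→c′ c′≢c ac→x with x Fin.≟ b
... | yes refl = no-R3-chain G free (edge-swap G ac→x) ab→c′ c′≢c
... | no x≢b = no-R3-chain G free (edge-swap G ab→c) ac→x x≢b

isZero exactlyOne atLeastTwo : ℕ → Bool
isZero zero = true
isZero (suc _) = false
exactlyOne (suc zero) = true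
exactlyOne _ = false
atLeastTwo (suc (suc _)) = true
atLeastTwo _ = false

atLeastTwo⇒2≤ : ∀ m → atLeastTwo m ≡ true → 2 ≤ m
atLeastTwo⇒2≤ (suc (suc m)) _ = s≤s (s≤s z≤n)

atLeastTwo⇒¬one : ∀ m → atLeastTwo m ≡ true → exactlyOne m ≡ false
atLeastTwo⇒¬one (suc (suc m)) _ = refl

codeg-by-type : ∀ m Z → (atLeastTwo m ≡ true → m ≤ Z) → m ≤ Z * ⟦ atLeastTwo m ⟧ + ⟦ exactlyOne m ⟧
codeg-by-type zero Z _ = z≤n
codeg-by-type (suc zero) Z _ = m≤n+m 1 (Z * 0)
codeg-by-type (suc (suc m)) Z dense⇒≤ =
  ≤-trans (dense⇒≤ refl) (≤-reflexive (sym (trans (+-identityʳ _) (*-identityʳ Z))))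

module Local {n} (G : Graph n) (free : Free R3 G) where

  dense single empty : Fin n → Fin n → Bool
  dense a b = atLeastTwo (codeg G a b)
  single a b = exactlyOne (codeg G a b)
  empty a b = not (a == b) ∧ isZero (codeg G a b)

  d l z deg : Fin n → ℕ
  d a = count (dense a)
  l a = count (single a)
  z a = count (empty a)
  deg a = sum (codeg G a)

  codeg-sym : ∀ a b → codeg G a b ≡ codeg G b a
  codeg-sym a b = sum-cong-≗ (λ c → cong ⟦_⟧ (Graph.sym G a b c))

  codeg-diag : ∀ a → codeg G a a ≡ 0
  codeg-diag a = count-none (edge G a a) (λ c e → false≢true (trans (sym (no-edge-on-diagonal G c refl)) e))

  dense-sym : ∀ a b → dense a b ≡ dense b a
  dense-sym a b = cong atLeastTwo (codeg-sym a b)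

  empty-sym : ∀ a b → empty a b ≡ empty b a
  empty-sym a b = cong₂ (λ x y → not x ∧ isZero y) (==-sym a b) (codeg-sym a b)

  pair-types : ∀ a b → ⟦ a == b ⟧ + ⟦ dense a b ⟧ + ⟦ single a b ⟧ + ⟦ empty a b ⟧ ≡ 1
  pair-types a b with a Fin.≟ b
  ... | yes refl rewrite codeg-diag a = refl
  ... | no _ with codeg G a b
  ...   | zero = refl
  ...   | suc zero = refl
  ...   | suc (suc _) = refl

  pair-count : ∀ a → suc (d a + l a + z a) ≡ n
  pair-count a = begin
    suc (d a + l a + z a)
      ≡⟨ cong (λ m → m + d a + l a + z a) (count-singleton a) ⟨
    count (a ==_) + d a + l a + z a
      ≡⟨ cong (λ m → m + z a) (cong (_+ l a) (∑-distrib-+ (λ b → ⟦ a == b ⟧) (λ b → ⟦ dense a b ⟧))) ⟨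
    sum (λ b → ⟦ a == b ⟧ + ⟦ dense a b ⟧) + l a + z a
      ≡⟨ cong (_+ z a) (∑-distrib-+ (λ b → ⟦ a == b ⟧ + ⟦ dense a b ⟧) (λ b → ⟦ single a b ⟧)) ⟨
    sum (λ b → ⟦ a == b ⟧ + ⟦ dense a b ⟧ + ⟦ single a b ⟧) + z a
      ≡⟨ ∑-distrib-+ (λ b → ⟦ a == b ⟧ + ⟦ dense a b ⟧ + ⟦ single a b ⟧) (λ b → ⟦ empty a b ⟧) ⟨
    sum (λ b → ⟦ a == b ⟧ + ⟦ dense a b ⟧ + ⟦ single a b ⟧ + ⟦ empty a b ⟧)
      ≡⟨ sum-cong-≗ (pair-types a) ⟩
    sum {n} (λ _ → 1)
      ≡⟨ trans (sum-const {n} 1) (*-identityʳ n) ⟩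
    n ∎
    where open ≡-Reasoning

  dense-head-empty : ∀ {a b c} → dense a b ≡ true → edge G a b c ≡ true → empty a c ≡ true
  dense-head-empty {a} {b} {c} ab-dense ab→c
    with c′ , c′≢c , ab→c′ ← another-witness (edge G a b) (atLeastTwo⇒2≤ (codeg G a b) ab-dense) ab→c
    rewrite ==-≢ (proj₁ (proj₂ (loopless G a b c ab→c)))
          | count-none (edge G a c) (λ x ac→x → two-heads-block G free ab→c ab→c′ c′≢c ac→x) = refl

  dense-head-empty′ : ∀ {a b c} → dense a b ≡ true → edge G a b c ≡ true → empty b c ≡ true
  dense-head-empty′ {a} {b} ab-dense ab→c = dense-head-empty (trans (dense-sym b a) ab-dense) (edge-swap G ab→c)

  codeg-bound : ∀ a b → codeg G a b ≤ z a * ⟦ dense a b ⟧ + ⟦ single a b ⟧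
  codeg-bound a b =
    codeg-by-type (codeg G a b) (z a) (λ ab-dense → count-mono (λ c → dense-head-empty {a} {b} {c} ab-dense))

  deg-decomposition : ∀ a → sum (λ b → z a * ⟦ dense a b ⟧ + ⟦ single a b ⟧) ≡ z a * d a + l a
  deg-decomposition a = trans (∑-distrib-+ (λ b → z a * ⟦ dense a b ⟧) (λ b → ⟦ single a b ⟧))
                              (cong (_+ l a) (sym (*-distribˡ-sum (z a) (λ b → ⟦ dense a b ⟧))))

  deg-bound : ∀ a → deg a ≤ z a * d a + l a
  deg-bound a = ≤-trans (sum-mono (codeg-bound a)) (≤-reflexive (deg-decomposition a))

  Saturated : Fin n → Set
  Saturated a = ∀ b c → dense a b ≡ true → empty a c ≡ true → edge G a b c ≡ true

  deg-tight : ∀ a → z a * d a + l a ≤ deg a → Saturated a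
  deg-tight a tight b c ab-dense ac-empty =
    trans (⊆-count-≡ (λ c → dense-head-empty {a} {b} {c} ab-dense) za≤codeg c) ac-empty
    where
    codeg≡ : codeg G a b ≡ z a * ⟦ dense a b ⟧ + ⟦ single a b ⟧
    codeg≡ = sum-tight (codeg-bound a) (≤-trans (≤-reflexive (deg-decomposition a)) tight) b
    za≤codeg : z a ≤ codeg G a b
    za≤codeg = ≤-reflexive (sym (begin
      codeg G a b                                 ≡⟨ codeg≡ ⟩
      z a * ⟦ dense a b ⟧ + ⟦ single a b ⟧        ≡⟨ cong₂ (λ p q → z a * ⟦ p ⟧ + ⟦ q ⟧) ab-dense
                                                         (atLeastTwo⇒¬one (codeg G a b) ab-dense) ⟩
      z a * 1 + 0                                 ≡⟨ trans (+-identityʳ _) (*-identityʳ (z a)) ⟩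
      z a                                         ∎))
      where open ≡-Reasoning

  cluster : Fin n → Fin n → Bool
  cluster a x = (a == x) ∨ dense a x

  cluster-count : ∀ a → count (cluster a) ≡ suc (d a)
  cluster-count a = trans (count-∨ (a ==_) (dense a) diagonal-not-dense) (cong (_+ d a) (count-singleton a))
    where
    diagonal-not-dense : ∀ x → (a == x) ≡ true → dense a x ≡ false
    diagonal-not-dense x a==x with refl ← ==-sound {a = a} {x} a==x = cong atLeastTwo (codeg-diag a)

  saturated-cluster-empty : ∀ {a c} → Saturated a → empty a c ≡ true → cluster a ⊆ empty c
  saturated-cluster-empty {a} {c} a-sat ac-empty x ax-cluster with a Fin.≟ x
  ... | yes refl = trans (empty-sym c a) ac-empty
  ... | no _ = trans (empty-sym c x) (dense-head-empty′ ax-cluster (a-sat x c ax-cluster ac-empty))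

  empty-complement : ∀ a → l a ≡ 0 → ∀ x → empty a x ≡ not (cluster a x)
  empty-complement a la≡0 x = classify (a == x) (dense a x) (single a x) (empty a x)
    (pair-types a x) (count-zero (single a) la≡0 x)
    where
    classify : ∀ p q r w → ⟦ p ⟧ + ⟦ q ⟧ + ⟦ r ⟧ + ⟦ w ⟧ ≡ 1 → r ≡ false → w ≡ not (p ∨ q)
    classify false false false true _ _ = refl
    classify false true false false _ _ = refl
    classify true false false false _ _ = refl
    classify false false false false () _
    classify false true false true () _
    classify true false false true () _
    classify true true _ _ () _
    classify _ _ true _ _ ()

  edge⇒dense : ∀ {a b c} → single a b ≡ false → edge G a b c ≡ true → dense a b ≡ true
  edge⇒dense {a} {b} {c} ab-not-single ab→c =
    positive (codeg G a b) ab-not-single (≤-trans (≤-reflexive (cong ⟦_⟧ (sym ab→c))) (term≤sum _ c))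
    where
    positive : ∀ m → exactlyOne m ≡ false → 1 ≤ m → atLeastTwo m ≡ true
    positive (suc (suc m)) _ _ = refl

  remaining⇒dense : ∀ {a b} → (a == b) ≡ false → single a b ≡ false → empty a b ≡ false → dense a b ≡ true
  remaining⇒dense {a} {b} = classify (a == b) (dense a b) (single a b) (empty a b) (pair-types a b)
    where
    classify : ∀ p q r w → ⟦ p ⟧ + ⟦ q ⟧ + ⟦ r ⟧ + ⟦ w ⟧ ≡ 1 → p ≡ false → r ≡ false → w ≡ false → q ≡ true
    classify false true false false _ _ _ _ = refl
    classify false false false false () _ _ _

  dense⇒not-empty : ∀ {a b} → dense a b ≡ true → empty a b ≡ false
  dense⇒not-empty {a} {b} ab-dense with codeg G a b
  dense⇒not-empty {a} {b} _ | suc (suc _) = ∧-zeroʳ (not (a == b))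

  bipartite-by-empty-pairs : (A : Fin n → Bool) → (∀ a → l a ≡ 0) → (∀ a → Saturated a) →
                             (∀ a b → empty a b ≡ (A a xor A b)) → IsBipartite G A
  bipartite-by-empty-pairs A no-single saturated empty≡ a b c = bool-ext edge⇒bip bip⇒edge
    where
    ab-not-single : single a b ≡ false
    ab-not-single = count-zero (single a) (no-single a) b
    edge⇒bip : edge G a b c ≡ true → bipartite-edge A a b c ≡ true
    edge⇒bip ab→c
      rewrite sym (empty≡ a b) | dense⇒not-empty (edge⇒dense ab-not-single ab→c)
            | ==-≢ (proj₁ (loopless G a b c ab→c))
            | sym (empty≡ a c) | dense-head-empty (edge⇒dense ab-not-single ab→c) ab→c = refl
    bip⇒edge : bipartite-edge A a b c ≡ true → edge G a b c ≡ true
    bip⇒edge bip with a≢b , Aa≡Ab , Aa≢Ac ← bipartite-edge-true A bip =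
      saturated a b c (remaining⇒dense (==-≢ a≢b) ab-not-single (trans (empty≡ a b) (≡⇒xor Aa≡Ab)))
                      (trans (empty≡ a c) (≢⇒xor Aa≢Ac))

  bipartite-structure : (∀ a → l a ≡ 0) → (∀ a → Saturated a) → ∀ a₀ →
                        (∀ x → z x ≤ opposite (cluster a₀) x) → IsBipartite G (cluster a₀)
  bipartite-structure no-single saturated a₀ few-empty =
    bipartite-by-empty-pairs A no-single saturated (λ x → empty-by-colour x (A x) refl)
    where
    A : Fin n → Bool
    A = cluster a₀
    empty-a₀ : ∀ y → empty a₀ y ≡ not (A y)
    empty-a₀ = empty-complement a₀ (no-single a₀)
    -- A vertex of the cluster inherits the empty pairs of a₀ by saturation; one outside
    -- the cluster forms empty pairs with the whole cluster.  Counting closes both cases.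
    empty-by-colour : ∀ x ax → A x ≡ ax → ∀ y → empty x y ≡ (ax xor A y)
    empty-by-colour x true Ax y = trans (sym (⊆-count-≡ a₀⊆x (≤-trans (few-empty x) #opposite) y)) (empty-a₀ y)
      where
      a₀⊆x : empty a₀ ⊆ empty x
      a₀⊆x y a₀y-empty with a₀ Fin.≟ x
      ... | yes refl = a₀y-empty
      ... | no _ = dense-head-empty′ Ax (saturated a₀ x y Ax a₀y-empty)
      #opposite : opposite A x ≤ count (empty a₀)
      #opposite = ≤-reflexive (trans (opposite-true A Ax) (sym (sum-cong-≗ (λ y → cong ⟦_⟧ (empty-a₀ y)))))
    empty-by-colour x false Ax y =
      sym (⊆-count-≡ (saturated-cluster-empty (saturated a₀) (trans (empty-a₀ x) (cong not Ax)))
                     (≤-trans (few-empty x) (≤-reflexive (opposite-false A Ax))) y)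

-- The arithmetic of the local bound: maximising z d + l subject to d + l + z = m.

mul-add-≤ : ∀ z d l → 1 ≤ z → z * d + l ≤ z * (d + l)
mul-add-≤ (suc z) d l _ = begin
  suc z * d + l             ≤⟨ +-monoʳ-≤ (suc z * d) (m≤m+n l (z * l)) ⟩
  suc z * d + suc z * l     ≡⟨ *-distribˡ-+ (suc z) d l ⟨
  suc z * (d + l)           ∎
  where open ≤-Reasoning

mul-add-tight : ∀ z d l → 2 ≤ z → z * (d + l) ≤ z * d + l → l ≡ 0
mul-add-tight z d zero _ _ = refl
mul-add-tight (suc zero) d (suc l) (s≤s ()) _
mul-add-tight (suc (suc z)) d (suc l) _ tight = ⊥-elim (<⇒≱ l<zl (+-cancelˡ-≤ (suc (suc z) * d) _ _ tight′))
  where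
  tight′ : suc (suc z) * d + suc (suc z) * suc l ≤ suc (suc z) * d + suc l
  tight′ = ≤-trans (≤-reflexive (sym (*-distribˡ-+ (suc (suc z)) d (suc l)))) tight
  l<zl : suc l < suc (suc z) * suc l
  l<zl = m<m+n (suc l) z<s

product-odd-sum : ∀ k z u → z + u ≡ suc (k + k) →
  ∃ λ v → z * u + v * suc v ≡ k * suc k × (v ≡ 0 → z ≡ k ⊎ z ≡ suc k)
product-odd-sum k z u sum≡ with ≤-<-connex z k
... | inj₁ z≤k with v , refl ← m≤n⇒∃[o]m+o≡n z≤k =
  v , identity , λ { refl → inj₁ (sym (+-identityʳ z)) }
  where
  u≡ : u ≡ z + (v + v) + 1
  u≡ = +-cancelˡ-≡ z u _ (trans sum≡ (arith z v))
    where
    arith : ∀ z v → suc (z + v + (z + v)) ≡ z + (z + (v + v) + 1)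
    arith = solve-∀
  identity : z * u + v * suc v ≡ (z + v) * suc (z + v)
  identity rewrite u≡ = arith z v
    where
    arith : ∀ z v → z * (z + (v + v) + 1) + v * suc v ≡ (z + v) * suc (z + v)
    arith = solve-∀
... | inj₂ k<z with v , refl ← m≤n⇒∃[o]m+o≡n k<z =
  v , identity , λ { refl → inj₂ (cong suc (+-identityʳ k)) }
  where
  k≡ : k ≡ u + v
  k≡ = +-cancelˡ-≡ (suc k) k (u + v) (trans (arith₁ k) (trans (sym sum≡) (arith₂ k u v)))
    where
    arith₁ : ∀ k → suc k + k ≡ suc (k + k)
    arith₁ = solve-∀
    arith₂ : ∀ k u v → suc (k + v) + u ≡ suc k + (u + v)
    arith₂ = solve-∀
  identity : suc (k + v) * u + v * suc v ≡ k * suc k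
  identity rewrite k≡ = arith u v
    where
    arith : ∀ u v → suc (u + v + v) * u + v * suc v ≡ (u + v) * suc (u + v)
    arith = solve-∀

product-even-sum : ∀ h z u → z + u ≡ h + h →
  ∃ λ v → z * u + v * v ≡ h * h × (v ≡ 0 → z ≡ h) × (suc h ≤ z → z ≡ h + v)
product-even-sum h z u sum≡ with ≤-<-connex z h
... | inj₁ z≤h with v , refl ← m≤n⇒∃[o]m+o≡n z≤h =
  v , identity , (λ { refl → sym (+-identityʳ z) }) , (λ h<z → ⊥-elim (<⇒≱ h<z (m≤m+n z v)))
  where
  u≡ : u ≡ z + (v + v)
  u≡ = +-cancelˡ-≡ z u _ (trans sum≡ (arith z v))
    where
    arith : ∀ z v → z + v + (z + v) ≡ z + (z + (v + v))
    arith = solve-∀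
  identity : z * u + v * v ≡ (z + v) * (z + v)
  identity rewrite u≡ = arith z v
    where
    arith : ∀ z v → z * (z + (v + v)) + v * v ≡ (z + v) * (z + v)
    arith = solve-∀
... | inj₂ h<z with v , refl ← m≤n⇒∃[o]m+o≡n (<⇒≤ h<z) =
  v , identity , (λ { refl → +-identityʳ h }) , (λ _ → refl)
  where
  h≡ : h ≡ u + v
  h≡ = +-cancelˡ-≡ h h (u + v) (trans (sym sum≡) (arith h u v))
    where
    arith : ∀ h u v → h + v + u ≡ h + (u + v)
    arith = solve-∀
  identity : (h + v) * u + v * v ≡ h * h
  identity rewrite h≡ = arith u v
    where
    arith : ∀ u v → (u + v + v) * u + v * v ≡ (u + v) * (u + v)
    arith = solve-∀

remaining-part : ∀ {d l z x y} → d + l + z ≡ x + y → l ≡ 0 → z ≡ y → d ≡ x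
remaining-part {d} {z = z} {x} sum≡ refl refl = +-cancelʳ-≡ z d x (trans (cong (_+ z) (sym (+-identityʳ d))) sum≡)

local-bound-odd : ∀ k {d l z} → 2 ≤ k → d + l + z ≡ suc (k + k) →
  z * d + l ≤ k * suc k × (k * suc k ≤ z * d + l → l ≡ 0 × (z ≡ k ⊎ z ≡ suc k))
local-bound-odd k {d} {l} {zero} 2≤k sum≡ = <⇒≤ l<bound , λ bound≤l → ⊥-elim (<⇒≱ l<bound bound≤l)
  where
  l<bound : l < k * suc k
  l<bound = begin-strict
    l                ≤⟨ m≤n+m l d ⟩
    d + l            ≡⟨ trans (sym (+-identityʳ (d + l))) sum≡ ⟩
    suc (k + k)      <⟨ n<1+n _ ⟩
    suc (suc (k + k)) ≡⟨ arith k ⟩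
    2 * suc k        ≤⟨ *-monoˡ-≤ (suc k) 2≤k ⟩
    k * suc k        ∎
    where
    open ≤-Reasoning
    arith : ∀ k → suc (suc (k + k)) ≡ 2 * suc k
    arith = solve-∀
local-bound-odd k {d} {l} {z@(suc _)} 2≤k sum≡
  with v , shortfall , balanced ← product-odd-sum k z (d + l) (trans (+-comm z (d + l)) sum≡) =
  ≤-trans moved (≤-trans (m≤m+n _ _) (≤-reflexive shortfall)) , tight
  where
  moved : z * d + l ≤ z * (d + l)
  moved = mul-add-≤ z d l (s≤s z≤n)
  tight : k * suc k ≤ z * d + l → l ≡ 0 × (z ≡ k ⊎ z ≡ suc k)
  tight bound≤ = mul-add-tight z d l 2≤z (≤-trans zu≤ bound≤) , z-balanced
    where
    zu≤ : z * (d + l) ≤ k * suc k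
    zu≤ = ≤-trans (m≤m+n _ _) (≤-reflexive shortfall)
    no-shortfall : v * suc v ≤ 0
    no-shortfall = +-cancelˡ-≤ (z * (d + l)) _ 0
      (≤-trans (≤-reflexive shortfall) (≤-trans bound≤ (≤-trans moved (≤-reflexive (sym (+-identityʳ _))))))
    z-balanced : z ≡ k ⊎ z ≡ suc k
    z-balanced = balanced (square-zero v no-shortfall)
      where
      square-zero : ∀ v → v * suc v ≤ 0 → v ≡ 0
      square-zero zero _ = refl
    2≤z : 2 ≤ z
    2≤z with z-balanced
    ... | inj₁ z≡k = subst (2 ≤_) (sym z≡k) 2≤k
    ... | inj₂ z≡1+k = subst (2 ≤_) (sym z≡1+k) (m≤n⇒m≤1+n 2≤k)

local-bound-even : ∀ h {d l z} → 3 ≤ h → d + l + z ≡ h + h →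
  z * d + l ≤ h * h × (h * h ≤ z * d + l → l ≡ 0 × z ≡ h)
local-bound-even h {d} {l} {zero} 3≤h sum≡ = <⇒≤ l<bound , λ bound≤l → ⊥-elim (<⇒≱ l<bound bound≤l)
  where
  l<bound : l < h * h
  l<bound = begin-strict
    l            ≤⟨ m≤n+m l d ⟩
    d + l        ≡⟨ trans (sym (+-identityʳ (d + l))) sum≡ ⟩
    h + h        <⟨ m<m+n (h + h) (≤-trans (s≤s z≤n) 3≤h) ⟩
    h + h + h    ≡⟨ arith h ⟩
    3 * h        ≤⟨ *-monoˡ-≤ h 3≤h ⟩
    h * h        ∎
    where
    open ≤-Reasoning
    arith : ∀ h → h + h + h ≡ 3 * h
    arith = solve-∀
local-bound-even h {d} {l} {z@(suc _)} 3≤h sum≡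
  with v , shortfall , balanced , _ ← product-even-sum h z (d + l) (trans (+-comm z (d + l)) sum≡) =
  ≤-trans moved zu≤ , tight
  where
  moved : z * d + l ≤ z * (d + l)
  moved = mul-add-≤ z d l (s≤s z≤n)
  zu≤ : z * (d + l) ≤ h * h
  zu≤ = ≤-trans (m≤m+n _ _) (≤-reflexive shortfall)
  tight : h * h ≤ z * d + l → l ≡ 0 × z ≡ h
  tight bound≤ = mul-add-tight z d l (subst (2 ≤_) (sym z≡h) (≤-trans (s≤s (s≤s z≤n)) 3≤h)) (≤-trans zu≤ bound≤) , z≡h
    where
    no-shortfall : v * v ≤ 0
    no-shortfall = +-cancelˡ-≤ (z * (d + l)) _ 0
      (≤-trans (≤-reflexive shortfall) (≤-trans bound≤ (≤-trans moved (≤-reflexive (sym (+-identityʳ _))))))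
    z≡h : z ≡ h
    z≡h = balanced (square-zero v no-shortfall)
      where
      square-zero : ∀ v → v * v ≤ 0 → v ≡ 0
      square-zero zero _ = refl

local-bound-even-large : ∀ h {d l z} → 3 ≤ h → d + l + z ≡ h + h → suc h ≤ z →
  suc (z * d + l) ≤ h * h × (h * h ≤ suc (z * d + l) → l ≡ 0 × z ≡ suc h)
local-bound-even-large h {d} {l} {z} 3≤h sum≡ h<z
  with v , shortfall , _ , z≡h+v ← product-even-sum h z (d + l) (trans (+-comm z (d + l)) sum≡) =
  ≤-trans (s≤s moved) zu<h² , tight
  where
  moved : z * d + l ≤ z * (d + l)
  moved = mul-add-≤ z d l (≤-trans (s≤s z≤n) h<z)
  1≤v : 1 ≤ v
  1≤v = positive v (z≡h+v h<z)
    where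
    positive : ∀ w → z ≡ h + w → 1 ≤ w
    positive zero z≡h = ⊥-elim (<-irrefl (sym (trans z≡h (+-identityʳ h))) h<z)
    positive (suc _) _ = s≤s z≤n
  zu<h² : suc (z * (d + l)) ≤ h * h
  zu<h² = ≤-trans (≤-reflexive (+-comm 1 _))
                  (≤-trans (+-monoʳ-≤ (z * (d + l)) (*-mono-≤ 1≤v 1≤v)) (≤-reflexive shortfall))
  tight : h * h ≤ suc (z * d + l) → l ≡ 0 × z ≡ suc h
  tight bound≤ = mul-add-tight z d l 2≤z (s≤s⁻¹ (≤-trans zu<h² bound≤)) , z≡1+h
    where
    v≡1 : v ≡ 1
    v≡1 = square-one v 1≤v (+-cancelˡ-≤ (z * (d + l)) _ 1
      (≤-trans (≤-reflexive shortfall) (≤-trans bound≤ (≤-trans (s≤s moved) (≤-reflexive (+-comm 1 _))))))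
      where
      square-one : ∀ v → 1 ≤ v → v * v ≤ 1 → v ≡ 1
      square-one (suc zero) _ _ = refl
      square-one (suc (suc v)) _ (s≤s ())
    z≡1+h : z ≡ suc h
    z≡1+h = trans (z≡h+v h<z) (trans (cong (h +_) v≡1) (+-comm h 1))
    2≤z : 2 ≤ z
    2≤z = ≤-trans (≤-trans (s≤s (s≤s z≤n)) 3≤h) (<⇒≤ h<z)

exValue-even : ∀ k → 2 * exValue (suc (suc (k + k))) ≡ suc (suc (k + k)) * (k * suc k)
exValue-even k rewrite sym (n≡⌊n+n/2⌋ k) | sym (n≡⌈n+n/2⌉ k) = begin
  2 * ((suc k * suc k * (k + k)) / 2)         ≡⟨ cong (λ m → 2 * (m / 2)) (arith₁ k) ⟩
  2 * ((suc k * (suc k * k) * 2) / 2)         ≡⟨ cong (2 *_) (m*n/n≡m (suc k * (suc k * k)) 2) ⟩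
  2 * (suc k * (suc k * k))                   ≡⟨ arith₂ k ⟩
  suc (suc (k + k)) * (k * suc k)             ∎
  where
  open ≡-Reasoning
  arith₁ : ∀ k → suc k * suc k * (k + k) ≡ suc k * (suc k * k) * 2
  arith₁ = solve-∀
  arith₂ : ∀ k → 2 * (suc k * (suc k * k)) ≡ suc (suc (k + k)) * (k * suc k)
  arith₂ = solve-∀

triangle : ℕ → ℕ
triangle zero = 0
triangle (suc k) = suc k + triangle k

triangle-double : ∀ k → triangle k * 2 ≡ k * suc k
triangle-double zero = refl
triangle-double (suc k) = begin
  (suc k + triangle k) * 2        ≡⟨ *-distribʳ-+ 2 (suc k) (triangle k) ⟩
  suc k * 2 + triangle k * 2      ≡⟨ cong (suc k * 2 +_) (triangle-double k) ⟩
  suc k * 2 + k * suc k           ≡⟨ arith k ⟩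
  suc k * suc (suc k)             ∎
  where
  open ≡-Reasoning
  arith : ∀ k → suc k * 2 + k * suc k ≡ suc k * suc (suc k)
  arith = solve-∀

exValue-odd : ∀ h → 2 * exValue (suc (h + h)) + h ≡ suc (h + h) * (h * h)
exValue-odd zero = refl
exValue-odd (suc h) rewrite +-suc h h | sym (n≡⌈n+n/2⌉ h) | sym (n≡⌊n+n/2⌋ h) = begin
  2 * ((suc h * suc (suc h) * suc (h + h)) / 2) + suc h
    ≡⟨ cong (λ m → 2 * ((m * suc (h + h)) / 2) + suc h) (triangle-double (suc h)) ⟨
  2 * ((t * 2 * suc (h + h)) / 2) + suc h
    ≡⟨ cong (λ m → 2 * (m / 2) + suc h) (arith₁ t h) ⟩
  2 * ((t * suc (h + h) * 2) / 2) + suc h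
    ≡⟨ cong (λ m → 2 * m + suc h) (m*n/n≡m (t * suc (h + h)) 2) ⟩
  2 * (t * suc (h + h)) + suc h
    ≡⟨ cong (_+ suc h) (arith₂ t h) ⟩
  t * 2 * suc (h + h) + suc h
    ≡⟨ cong (λ m → m * suc (h + h) + suc h) (triangle-double (suc h)) ⟩
  suc h * suc (suc h) * suc (h + h) + suc h
    ≡⟨ arith₃ h ⟩
  suc (suc (suc (h + h))) * (suc h * suc h) ∎
  where
  open ≡-Reasoning
  t : ℕ
  t = triangle (suc h)
  arith₁ : ∀ t h → t * 2 * suc (h + h) ≡ t * suc (h + h) * 2
  arith₁ = solve-∀
  arith₂ : ∀ t h → 2 * (t * suc (h + h)) ≡ t * 2 * suc (h + h)
  arith₂ = solve-∀
  arith₃ : ∀ h → suc h * suc (suc h) * suc (h + h) + suc h ≡ suc (suc (suc (h + h))) * (suc h * suc h)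
  arith₃ = solve-∀

module EvenCase (k : ℕ) (2≤k : 2 ≤ k) {n} (n≡ : n ≡ suc (suc (k + k))) (G : Graph n) (free : Free R3 G) where
  open Local G free

  local-sum : ∀ a → d a + l a + z a ≡ suc (k + k)
  local-sum a = suc-injective (trans (pair-count a) n≡)

  local-bound : ∀ a → z a * d a + l a ≤ k * suc k × (k * suc k ≤ z a * d a + l a → l a ≡ 0 × (z a ≡ k ⊎ z a ≡ suc k))
  local-bound a = local-bound-odd k 2≤k (local-sum a)

  deg≤ : ∀ a → deg a ≤ k * suc k
  deg≤ a = ≤-trans (deg-bound a) (proj₁ (local-bound a))

  twice-exValue : n * (k * suc k) ≡ 2 * exValue n
  twice-exValue =
    trans (cong (_* (k * suc k)) n≡) (trans (sym (exValue-even k)) (cong (λ m → 2 * exValue m) (sym n≡)))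

  edge-bound : edgeCount G ≤ exValue n
  edge-bound = *-cancelˡ-≤ 2 (begin
    2 * edgeCount G     ≡⟨ codeg-sum G ⟨
    sum deg             ≤⟨ sum-mono deg≤ ⟩
    sum {n} (λ _ → k * suc k) ≡⟨ sum-const {n} (k * suc k) ⟩
    n * (k * suc k)     ≡⟨ twice-exValue ⟩
    2 * exValue n       ∎)
    where open ≤-Reasoning

  -- In an extremal graph all local bounds are attained; then every vertex has exactly
  -- k + 1 empty pairs (a vertex with only k would have k + 1 dense partners, so an empty
  -- partner of it would have k + 2 empty pairs), and G is bipartite with classes of size k + 1.
  module Extremal (extremal : edgeCount G ≡ exValue n) where

    deg≡ : ∀ a → deg a ≡ k * suc k
    deg≡ = sum-tight deg≤ (begin
      sum {n} (λ _ → k * suc k) ≡⟨ sum-const {n} (k * suc k) ⟩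
      n * (k * suc k)     ≡⟨ twice-exValue ⟩
      2 * exValue n       ≡⟨ cong (2 *_) extremal ⟨
      2 * edgeCount G     ≡⟨ codeg-sum G ⟨
      sum deg             ∎)
      where open ≤-Reasoning

    tight : ∀ a → l a ≡ 0 × (z a ≡ k ⊎ z a ≡ suc k)
    tight a = proj₂ (local-bound a) (≤-trans (≤-reflexive (sym (deg≡ a))) (deg-bound a))

    saturated : ∀ a → Saturated a
    saturated a = deg-tight a (≤-trans (proj₁ (local-bound a)) (≤-reflexive (sym (deg≡ a))))

    no-single : ∀ a → l a ≡ 0
    no-single a = proj₁ (tight a)

    z≤ : ∀ a → z a ≤ suc k
    z≤ a with proj₂ (tight a)
    ... | inj₁ za≡k = ≤-trans (≤-reflexive za≡k) (n≤1+n k)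
    ... | inj₂ za≡1+k = ≤-reflexive za≡1+k

    -- If z a = k, then d a = k + 1, and any c with ac empty would have z c ≥ k + 2.
    z≡ : ∀ a → z a ≡ suc k
    z≡ a with proj₂ (tight a)
    ... | inj₂ za≡1+k = za≡1+k
    ... | inj₁ za≡k
      with c , ac-empty ← count-pos (empty a) (≤-trans (≤-trans (s≤s z≤n) 2≤k) (≤-reflexive (sym za≡k))) =
      ⊥-elim (<⇒≱ (s≤s (z≤ c)) (begin
        suc (suc k)           ≡⟨ cong suc da≡1+k ⟨
        suc (d a)             ≡⟨ cluster-count a ⟨
        count (cluster a)     ≤⟨ count-mono (saturated-cluster-empty (saturated a) ac-empty) ⟩
        z c                   ∎))
      where
      open ≤-Reasoning
      da≡1+k : d a ≡ suc k
      da≡1+k = remaining-part (local-sum a) (no-single a) za≡k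

    a₀ : Fin n
    a₀ = subst Fin (sym n≡) zero

    colour : Fin n → Bool
    colour = cluster a₀

    #colour : count colour ≡ suc k
    #colour = trans (cluster-count a₀)
                    (cong suc (remaining-part (trans (local-sum a₀) (sym (+-suc k k))) (no-single a₀) (z≡ a₀)))

    #other : count (not ∘ colour) ≡ suc k
    #other = +-cancelˡ-≡ (suc k) _ _ (begin
      suc k + count (not ∘ colour)      ≡⟨ cong (_+ count (not ∘ colour)) #colour ⟨
      count colour + count (not ∘ colour) ≡⟨ count-compl colour ⟩
      n                                 ≡⟨ trans n≡ (cong suc (sym (+-suc k k))) ⟩
      suc k + suc k                     ∎)
      where open ≡-Reasoning

    few-empty : ∀ x → z x ≤ opposite colour x
    few-empty x = ≤-trans (≤-reflexive (z≡ x)) (≤-reflexive (sym (opposite-size (colour x) refl)))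
      where
      opposite-size : ∀ c → colour x ≡ c → opposite colour x ≡ suc k
      opposite-size true x-in = trans (opposite-true colour x-in) #other
      opposite-size false x-out = trans (opposite-false colour x-out) #colour

    is-bipartite : IsBipartite G colour
    is-bipartite = bipartite-structure no-single saturated a₀ few-empty

-- Odd n = 2h + 1 (h ≥ 3): every local degree is at most h², but the vertices attaining
-- h² ("full" vertices) all lie in one cluster of size h + 1.
module OddCase (h : ℕ) (3≤h : 3 ≤ h) {n} (n≡ : n ≡ suc (h + h)) (G : Graph n) (free : Free R3 G) where
  open Local G free

  local-sum : ∀ a → d a + l a + z a ≡ h + h
  local-sum a = suc-injective (trans (pair-count a) n≡)

  deg≤ : ∀ a → deg a ≤ h * h
  deg≤ a = ≤-trans (deg-bound a) (proj₁ (local-bound-even h {d a} {l a} {z a} 3≤h (local-sum a)))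

  full : Fin n → Bool
  full a = deg a ≡ᵇ h * h

  full-deg : ∀ {a} → full a ≡ true → deg a ≡ h * h
  full-deg {a} a-full = ≡ᵇ⇒≡ (deg a) (h * h) (subst T (sym a-full) tt)

  deg-full-bound : ∀ a → deg a + 1 ≤ h * h + ⟦ full a ⟧
  deg-full-bound a with full a in a-full
  ... | true = ≤-reflexive (cong (_+ 1) (full-deg a-full))
  ... | false = ≤-trans (≤-reflexive (+-comm (deg a) 1))
                        (≤-trans (≤∧≢⇒< (deg≤ a) not-full) (≤-reflexive (sym (+-identityʳ _))))
    where
    not-full : deg a ≢ h * h
    not-full deg≡ = subst T a-full (≡⇒≡ᵇ (deg a) (h * h) deg≡)

  record FullVertex (a : Fin n) : Set where
    field
      no-single : l a ≡ 0
      #empty : z a ≡ h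
      #dense : d a ≡ h
      saturated : Saturated a

  full-vertex : ∀ {a} → full a ≡ true → FullVertex a
  full-vertex {a} a-full = record
    { no-single = proj₁ tight ; #empty = proj₂ tight
    ; #dense = remaining-part (local-sum a) (proj₁ tight) (proj₂ tight)
    ; saturated = deg-tight a (≤-trans (proj₁ bound) (≤-reflexive (sym (full-deg a-full)))) }
    where
    bound : z a * d a + l a ≤ h * h × (h * h ≤ z a * d a + l a → l a ≡ 0 × z a ≡ h)
    bound = local-bound-even h 3≤h (local-sum a)
    tight : l a ≡ 0 × z a ≡ h
    tight = proj₂ bound (≤-trans (≤-reflexive (sym (full-deg a-full))) (deg-bound a))

  -- Two full vertices a, c are in one cluster: otherwise ac would be empty, and c would
  -- form empty pairs with all h + 1 vertices of the cluster of a.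
  full-cluster : ∀ {a c} → full a ≡ true → full c ≡ true → cluster a c ≡ true
  full-cluster {a} {c} a-full c-full with cluster a c in ac-cluster
  ... | true = refl
  ... | false = ⊥-elim (<-irrefl refl (begin-strict
      h                   ≡⟨ FullVertex.#dense fa ⟨
      d a                 <⟨ n<1+n (d a) ⟩
      suc (d a)           ≡⟨ cluster-count a ⟨
      count (cluster a)   ≤⟨ count-mono (saturated-cluster-empty (FullVertex.saturated fa) ac-empty) ⟩
      z c                 ≡⟨ FullVertex.#empty (full-vertex c-full) ⟩
      h                   ∎))
    where
    open ≤-Reasoning
    fa : FullVertex a
    fa = full-vertex a-full
    ac-empty : empty a c ≡ true
    ac-empty = trans (empty-complement a (FullVertex.no-single fa) c) (cong not ac-cluster)

  #full≤ : count full ≤ suc h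
  #full≤ with Finₚ.any? (λ a → full a Bool.≟ true)
  ... | yes (a , a-full) =
    ≤-trans (count-mono (λ c → full-cluster {a} {c} a-full))
            (≤-reflexive (trans (cluster-count a) (cong suc (FullVertex.#dense (full-vertex a-full)))))
  ... | no none = ≤-trans (≤-reflexive (count-none full (λ a a-full → none (a , a-full)))) z≤n

  -- Summing deg a + 1 ≤ h² + [a is full] over all vertices:  2 e(G) + n ≤ n h² + (h + 1) = 2 ex(n) + n.
  sum-deg+1 : sum (λ a → deg a + 1) ≡ 2 * edgeCount G + n
  sum-deg+1 =
    trans (∑-distrib-+ deg (λ _ → 1)) (cong₂ _+_ (codeg-sum G) (trans (sum-const {n} 1) (*-identityʳ n)))

  sum-full-bound : sum (λ a → h * h + ⟦ full a ⟧) ≡ n * (h * h) + count full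
  sum-full-bound =
    trans (∑-distrib-+ (λ _ → h * h) (λ a → ⟦ full a ⟧)) (cong (_+ count full) (sum-const {n} (h * h)))

  accounting : n * (h * h) + suc h ≡ 2 * exValue n + n
  accounting = begin
    n * (h * h) + suc h                    ≡⟨ cong (λ m → m * (h * h) + suc h) n≡ ⟩
    suc (h + h) * (h * h) + suc h          ≡⟨ cong (_+ suc h) (exValue-odd h) ⟨
    2 * exValue (suc (h + h)) + h + suc h  ≡⟨ +-assoc _ h (suc h) ⟩
    2 * exValue (suc (h + h)) + (h + suc h) ≡⟨ cong (2 * exValue (suc (h + h)) +_) (+-suc h h) ⟩
    2 * exValue (suc (h + h)) + suc (h + h) ≡⟨ cong (λ m → 2 * exValue m + m) n≡ ⟨
    2 * exValue n + n                      ∎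
    where open ≡-Reasoning

  edge-bound : edgeCount G ≤ exValue n
  edge-bound = *-cancelˡ-≤ 2 (+-cancelʳ-≤ n _ _ (begin
    2 * edgeCount G + n                ≡⟨ sum-deg+1 ⟨
    sum (λ a → deg a + 1)              ≤⟨ sum-mono deg-full-bound ⟩
    sum (λ a → h * h + ⟦ full a ⟧)     ≡⟨ sum-full-bound ⟩
    n * (h * h) + count full           ≤⟨ +-monoʳ-≤ (n * (h * h)) #full≤ ⟩
    n * (h * h) + suc h                ≡⟨ accounting ⟩
    2 * exValue n + n                  ∎))
    where open ≤-Reasoning

  -- In an extremal graph there are exactly h + 1 full vertices, forming the cluster of any
  -- of them; every other vertex has local degree h² − 1, which forces it to have no single
  -- pairs, h + 1 empty pairs, and to be saturated.  So G is bipartite with classes h + 1, h.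
  module Extremal (extremal : edgeCount G ≡ exValue n) where

    total : sum (λ a → deg a + 1) ≡ n * (h * h) + suc h
    total = trans sum-deg+1 (trans (cong (λ m → 2 * m + n) extremal) (sym accounting))

    h<#full : suc h ≤ count full
    h<#full = +-cancelˡ-≤ (n * (h * h)) _ _ (begin
      n * (h * h) + suc h            ≡⟨ total ⟨
      sum (λ a → deg a + 1)          ≤⟨ sum-mono deg-full-bound ⟩
      sum (λ a → h * h + ⟦ full a ⟧) ≡⟨ sum-full-bound ⟩
      n * (h * h) + count full       ∎)
      where open ≤-Reasoning

    deg-full≡ : ∀ a → deg a + 1 ≡ h * h + ⟦ full a ⟧
    deg-full≡ = sum-tight deg-full-bound (begin
      sum (λ a → h * h + ⟦ full a ⟧) ≡⟨ sum-full-bound ⟩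
      n * (h * h) + count full       ≤⟨ +-monoʳ-≤ (n * (h * h)) #full≤ ⟩
      n * (h * h) + suc h            ≡⟨ total ⟨
      sum (λ a → deg a + 1)          ∎)
      where open ≤-Reasoning

    a₀ : Fin n
    a₀ = proj₁ (count-pos full (≤-trans (s≤s z≤n) h<#full))

    a₀-full : full a₀ ≡ true
    a₀-full = proj₂ (count-pos full (≤-trans (s≤s z≤n) h<#full))

    colour : Fin n → Bool
    colour = cluster a₀

    #colour : count colour ≡ suc h
    #colour = trans (cluster-count a₀) (cong suc (FullVertex.#dense (full-vertex a₀-full)))

    #other : count (not ∘ colour) ≡ h
    #other = +-cancelˡ-≡ (suc h) _ _ (begin
      suc h + count (not ∘ colour)        ≡⟨ cong (_+ count (not ∘ colour)) #colour ⟨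
      count colour + count (not ∘ colour) ≡⟨ count-compl colour ⟩
      n                                   ≡⟨ n≡ ⟩
      suc h + h                           ∎)
      where open ≡-Reasoning

    full≡colour : ∀ x → full x ≡ colour x
    full≡colour = ⊆-count-≡ (λ x → full-cluster {a₀} {x} a₀-full) (≤-trans (≤-reflexive #colour) h<#full)

    record Balanced (x : Fin n) : Set where
      field
        no-single : l x ≡ 0
        saturated : Saturated x
        few-empty : z x ≤ opposite colour x

    balanced : ∀ x c → colour x ≡ c → Balanced x
    balanced x true x-in = record
      { no-single = FullVertex.no-single fx ; saturated = FullVertex.saturated fx
      ; few-empty = ≤-reflexive (trans (FullVertex.#empty fx) (sym (trans (opposite-true colour x-in) #other))) }
      where
      fx : FullVertex x
      fx = full-vertex (trans (full≡colour x) x-in)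
    balanced x false x-out = record
      { no-single = proj₁ tight ; saturated = deg-tight x (s≤s⁻¹ (≤-trans (proj₁ bound) h²≤))
      ; few-empty = ≤-reflexive (trans (proj₂ tight) (sym (trans (opposite-false colour x-out) #colour))) }
      where
      h²≤ : h * h ≤ suc (deg x)
      h²≤ = ≤-reflexive (sym (begin
        suc (deg x)                  ≡⟨ +-comm 1 (deg x) ⟩
        deg x + 1                    ≡⟨ deg-full≡ x ⟩
        h * h + ⟦ full x ⟧           ≡⟨ cong (λ b → h * h + ⟦ b ⟧) (trans (full≡colour x) x-out) ⟩
        h * h + 0                    ≡⟨ +-identityʳ (h * h) ⟩
        h * h                        ∎))
        where open ≡-Reasoning
      many-empty : suc h ≤ z x
      many-empty = ≤-trans (≤-reflexive (sym #colour))
        (count-mono (saturated-cluster-empty (FullVertex.saturated (full-vertex a₀-full))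
          (trans (empty-complement a₀ (FullVertex.no-single (full-vertex a₀-full)) x) (cong not x-out))))
      bound : suc (z x * d x + l x) ≤ h * h × (h * h ≤ suc (z x * d x + l x) → l x ≡ 0 × z x ≡ suc h)
      bound = local-bound-even-large h 3≤h (local-sum x) many-empty
      tight : l x ≡ 0 × z x ≡ suc h
      tight = proj₂ bound (≤-trans h²≤ (s≤s (deg-bound x)))

    is-bipartite : IsBipartite G colour
    is-bipartite = bipartite-structure (λ x → Balanced.no-single (balanced x (colour x) refl))
                                       (λ x → Balanced.saturated (balanced x (colour x) refl))
                                       a₀ (λ x → Balanced.few-empty (balanced x (colour x) refl))

ExtremalUnique : ℕ → Set
ExtremalUnique n =
  IsEx R3 n (exValue n)
  × ((G H : Graph n) → Free R3 G → Free R3 H → edgeCount G ≡ exValue n → edgeCount H ≡ exValue n → G ≅ H)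

extremal-unique : ∀ {n} (A : Fin n → Bool) (c : ℕ) → edgeCount (bipartite A) ≡ exValue n →
  (∀ G → Free R3 G → edgeCount G ≤ exValue n) →
  (∀ G → Free R3 G → edgeCount G ≡ exValue n → Σ (Fin n → Bool) λ B → IsBipartite G B × count B ≡ c) →
  ExtremalUnique n
extremal-unique A c A-extremal bound structure =
  ((bipartite A , bipartite-free A , A-extremal) , bound) , λ G H G-free H-free G-extremal H-extremal →
    let (B , G≡B , #B) = structure G G-free G-extremal
        (B′ , H≡B′ , #B′) = structure H H-free H-extremal
    in bipartite-≅ G H G≡B H≡B′ (trans #B (sym #B′))

count-initial-compl : ∀ {n} c m → c + m ≡ n → count {n} (not ∘ initial c) ≡ m
count-initial-compl {n} c m c+m≡n =
  +-cancelˡ-≡ c _ _ (trans (cong (_+ count {n} (not ∘ initial c)) (sym #initial))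
                           (trans (count-compl (initial c)) (sym c+m≡n)))
  where
  #initial : count {n} (initial c) ≡ c
  #initial = count-initial n c (≤-trans (m≤m+n c m) (≤-reflexive c+m≡n))

even-case : ∀ k → 2 ≤ k → ExtremalUnique (suc (suc (k + k)))
even-case k 2≤k = extremal-unique A (suc k) A-extremal
  (λ G free → EvenCase.edge-bound k 2≤k refl G free)
  (λ G free extremal → let open EvenCase.Extremal k 2≤k refl G free extremal in colour , is-bipartite , #colour)
  where
  n : ℕ
  n = suc (suc (k + k))
  A : Fin n → Bool
  A = initial (suc k)
  A-extremal : edgeCount (bipartite A) ≡ exValue n
  A-extremal = *-cancelˡ-≡ _ _ 2 (begin
    2 * edgeCount (bipartite A)
      ≡⟨ bipartite-edge-count A (count-initial n (suc k) (s≤s (≤-trans (m≤m+n k k) (n≤1+n _))))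
                                (count-initial-compl (suc k) (suc k) (cong suc (+-suc k k))) ⟩
    suc k * (k * suc k) + suc k * (k * suc k)    ≡⟨ arith k ⟩
    n * (k * suc k)                               ≡⟨ exValue-even k ⟨
    2 * exValue n                                 ∎)
    where
    open ≡-Reasoning
    arith : ∀ k → suc k * (k * suc k) + suc k * (k * suc k) ≡ suc (suc (k + k)) * (k * suc k)
    arith = solve-∀

odd-case : ∀ h → 3 ≤ h → ExtremalUnique (suc (h + h))
odd-case h@(suc h′) 3≤h = extremal-unique A (suc h) A-extremal
  (λ G free → OddCase.edge-bound h 3≤h refl G free)
  (λ G free extremal → let open OddCase.Extremal h 3≤h refl G free extremal in colour , is-bipartite , #colour)
  where
  n : ℕ
  n = suc (h + h)
  A : Fin n → Bool
  A = initial (suc h)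
  A-extremal : edgeCount (bipartite A) ≡ exValue n
  A-extremal = *-cancelˡ-≡ _ _ 2 (+-cancelʳ-≡ h _ _ (begin
    2 * edgeCount (bipartite A) + h
      ≡⟨ cong (_+ h) (bipartite-edge-count A (count-initial n (suc h) (s≤s (m≤m+n h h)))
                                             (count-initial-compl (suc h) h refl)) ⟩
    suc h * (h * suc h′) + suc h′ * (h′ * suc h) + h    ≡⟨ arith h′ ⟩
    n * (h * h)                                          ≡⟨ exValue-odd h ⟨
    2 * exValue n + h                                    ∎))
    where
    open ≡-Reasoning
    arith : ∀ h′ → suc (suc h′) * (suc h′ * suc h′) + suc h′ * (h′ * suc (suc h′)) + suc h′
                   ≡ suc (suc h′ + suc h′) * (suc h′ * suc h′)
    arith = solve-∀

halve : ∀ m → ∃ λ j → m ≡ j + j ⊎ m ≡ suc (j + j)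
halve zero = 0 , inj₁ refl
halve (suc zero) = 0 , inj₂ refl
halve (suc (suc m)) with halve m
... | j , inj₁ refl = suc j , inj₁ (cong suc (sym (+-suc j j)))
... | j , inj₂ refl = suc j , inj₂ (cong (λ m → suc (suc m)) (sym (+-suc j j)))

even-or-odd : ∀ n → 6 ≤ n → (∃ λ k → 2 ≤ k × n ≡ suc (suc (k + k))) ⊎ (∃ λ h → 3 ≤ h × n ≡ suc (h + h))
even-or-odd n 6≤n with m , refl ← m≤n⇒∃[o]m+o≡n 6≤n with halve m
... | j , inj₁ refl = inj₁ (j + 2 , m≤n+m 2 j , arith j)
  where
  arith : ∀ j → 6 + (j + j) ≡ suc (suc (j + 2 + (j + 2)))
  arith = solve-∀
... | j , inj₂ refl = inj₂ (j + 3 , m≤n+m 3 j , arith j)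
  where
  arith : ∀ j → 6 + suc (j + j) ≡ suc (j + 3 + (j + 3))
  arith = solve-∀

theorem3 : (n : ℕ) → 6 ≤ n →
    IsEx R3 n (exValue n)
    × ((G H : Graph n) → Free R3 G → Free R3 H →
       edgeCount G ≡ exValue n → edgeCount H ≡ exValue n → G ≅ H)
theorem3 n 6≤n with even-or-odd n 6≤n
... | inj₁ (k , 2≤k , refl) = even-case k 2≤k
... | inj₂ (h , 3≤h , refl) = odd-case h 3≤h
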